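{- Consider the two-machine makespan problem with $n$ jobs whose processing times $p_1,\dots,p_n\in\{1,\dots,n\}$ are independent random variables with $c_1/n\le \Pr(p_j=i)\le c_2/n$ for all $i,j\in\{1,\dots,n\}$, for constants $c_1,c_2>0$, and which remain fixed after a one-time change. Regardless of the initial solution, with high probability the (1+1) EA obtains a solution of discrepancy $O(\log n)$ within $O(n^4\log n)$ iterations.
   Context: A candidate solution is $x\in\{0,1\}^n$; job $i$ is on machine $M_1$ if $x_i=0$ and on $M_2$ if $x_i=1$. Makespan $f(x)=\max\{\sum_i p_i(1-x_i),\sum_i p_ix_i\}$; discrepancy $d(x)=|\sum_i p_i(1-x_i)-\sum_i p_ix_i|$. The (1+1) EA repeats: let $y$ be obtained from $x$ by flipping each bit independently with probability $1/n$; if $f(y)\le f(x)$ then $x\gets y$. Random model: each job size performs a fair $\pm1$ random walk on $\{1,\dots,n\}$ with reflecting barriers (size $n$ goes to $n-1$, size $1$ goes to $2$), at most one job changed at a time, the job being chosen by an adversary; the mixing time is assumed to have elapsed so that the stated bracketing $c_1/n\le\Pr(p_j=i)\le c_2/n$ holds. "With high probability" means with probability at least $1-O(n^{ -c})$ for any constant $c>0$ (the constants in the $O$-bounds may depend on $c$).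
   Formalization: The constants c₁, c₂ and the probabilities $\Pr(p_j=i)$ of the job sizes are rational. -}

module Defs where

open import Data.Bool using (Bool; true; false; if_then_else_; _∧_; not; _xor_)
open import Data.Nat using (ℕ; zero; suc; _⊔_; ∣_-_∣; _≤ᵇ_; _∸_; NonZero)
import Data.Nat as ℕ
open import Data.Fin using (Fin; toℕ)
open import Data.Vec using (Vec; []; _∷_; zipWith)
open import Data.Vec.Properties using (≡-dec)
open import Data.List using (List; []; _∷_; map; foldr; concatMap; allFin)
open import Data.Integer using (+_)
open import Data.Rational using (ℚ; 0ℚ; 1ℚ; _+_; _*_; _-_; _/_)
open import Relation.Nullary.Decidable using (⌊_⌋)
import Data.Bool as B

Σℚ : List ℚ → ℚ
Σℚ = foldr _+_ 0ℚ

_^ℚ_ : ℚ → ℕ → ℚ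
q ^ℚ zero = 1ℚ
q ^ℚ suc k = q * (q ^ℚ k)

[_] : Bool → ℚ
[ b ] = if b then 1ℚ else 0ℚ

allVec : {A : Set} → List A → (k : ℕ) → List (Vec A k)
allVec xs zero = [] ∷ []
allVec xs (suc k) = concatMap (λ a → map (a ∷_) (allVec xs k)) xs

-- An instance: p_j ∈ {1..n} encoded as Fin n (value toℕ i + 1)
Instance : ℕ → Set
Instance n = Vec (Fin n) n

size : {n : ℕ} → Fin n → ℕ
size i = suc (toℕ i)

-- candidate solution x ∈ {0,1}^n (false = machine M1, true = machine M2)
Bits : ℕ → Set
Bits n = Vec Bool n

allBits : (n : ℕ) → List (Bits n)
allBits n = allVec (false ∷ true ∷ []) n

allInstances : (n : ℕ) → List (Instance n)
allInstances n = allVec (allFin n) n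

sumℕ : {k : ℕ} → Vec ℕ k → ℕ
sumℕ [] = 0
sumℕ (x ∷ xs) = x ℕ.+ sumℕ xs

load₁ load₂ : {n : ℕ} → Instance n → Bits n → ℕ
load₁ p x = sumℕ (zipWith (λ s b → if b then 0 else size s) p x)
load₂ p x = sumℕ (zipWith (λ s b → if b then size s else 0) p x)

makespan : {n : ℕ} → Instance n → Bits n → ℕ
makespan p x = load₁ p x ⊔ load₂ p x

discrepancy : {n : ℕ} → Instance n → Bits n → ℕ
discrepancy p x = ∣ load₁ p x - load₂ p x ∣

_==_ : {n : ℕ} → Bits n → Bits n → Bool
x == y = ⌊ ≡-dec B._≟_ x y ⌋

hamming : {n : ℕ} → Bits n → Bits n → ℕ
hamming x y = sumℕ (zipWith (λ a b → if a xor b then 1 else 0) x y)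

mutProb : (n : ℕ) .{{_ : NonZero n}} → Bits n → Bits n → ℚ
mutProb n x y = ((+ 1 / n) ^ℚ h) * ((1ℚ - (+ 1 / n)) ^ℚ (n ∸ h))
  where h = hamming x y

eaKernel : (n : ℕ) .{{_ : NonZero n}} → Instance n → Bits n → Bits n → ℚ
eaKernel n p x y = Σℚ (map (λ z → mutProb n x z *
   (if makespan p z ≤ᵇ makespan p x then [ z == y ] else [ x == y ])) (allBits n))

-- notHit n p B x₀ t y = Pr(x_t = y and no x_s (0 ≤ s ≤ t) has discrepancy ≤ B)
notHit : (n : ℕ) .{{_ : NonZero n}} → Instance n → ℕ → Bits n → ℕ → Bits n → ℚ
notHit n p B x₀ zero y = [ (y == x₀) ∧ not (discrepancy p y ≤ᵇ B) ]
notHit n p B x₀ (suc t) y =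
  [ not (discrepancy p y ≤ᵇ B) ] *
  Σℚ (map (λ x → notHit n p B x₀ t x * eaKernel n p x y) (allBits n))

-- probability that the (1+1) EA started in x₀ does NOT reach a solution of
-- discrepancy ≤ B within T iterations
failProb : (n : ℕ) .{{_ : NonZero n}} → Instance n → ℕ → Bits n → ℕ → ℚ
failProb n p B x₀ T = Σℚ (map (notHit n p B x₀ T) (allBits n))

-- product-measure probability of instance p when p_j has law μ j
-- (μ j i = Pr(p_j = toℕ i + 1))
instProb : {n k : ℕ} → (Fin k → Fin n → ℚ) → Vec (Fin n) k → ℚ
instProb μ [] = 1ℚ
instProb μ (i ∷ is) = μ Fin.zero i * instProb (λ j → μ (Fin.suc j)) is
  where import Data.Fin as Fin

-- overall failure probability: random instance with independent sizes of
-- laws μ, initial solution chosen (arbitrarily, possibly depending on the instance) by x₀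
totalFailProb : (n : ℕ) .{{_ : NonZero n}} → (Fin n → Fin n → ℚ) →
                (Instance n → Bits n) → ℕ → ℕ → ℚ
totalFailProb n μ x₀ B T =
  Σℚ (map (λ p → instProb μ p * failProb n p B (x₀ p) T) (allInstances n))

module Submission where

-- Call an instance B-dense if every window [s, s+B) of size values contains a job size.
--  * Improvement: on a B-dense instance every solution of discrepancy > B has a neighbour at
--    Hamming distance ≤ 2 with strictly smaller makespan (move one job, or swap two jobs whose
--    sizes differ by at most B).
--  * Drift: that neighbour is produced with probability ≥ q = n⁻²(1-1/n)ⁿ, so the potential
--    2^makespan shrinks in expectation by the factor ρ = 1 - q/2 per step; hence a fixed dense
--    instance fails within T steps with probability ≤ ρ^T 2^(n²).
--  * Windows: a window is empty with probability ≤ (1 - c₁B/n)ⁿ; a union bound over the n+1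
--    windows bounds the probability that the instance is not dense.
--  * Estimates turn both terms into ≤ n^(-c) for B = 2A(c+2)⌈log₂ n⌉ (c₁A ≥ 1) and
--    T = 32(1+c)n⁴⌈log₂ n⌉; Assembly averages over instances and theorem4 concludes.


module RationalArith where

  open import Data.Nat using (ℕ; zero; suc; NonZero)
  import Data.Nat as N
  import Data.Nat.Properties as NP
  open import Data.Nat.Coprimality using (gcd≡1⇒coprime; 1-coprimeTo)
  open import Data.Nat.GCD using (gcd-zeroʳ)
  import Data.Nat.Solver
  open import Data.Integer using (+_)
  import Data.Integer as Z
  import Data.Integer.Properties as ZP
  open import Data.Rational hiding (NonZero)
  open import Data.Rational.Properties
  import Data.Rational.Unnormalised as U
  import Data.Rational.Unnormalised.Properties as UP
  open import Data.Rational.Solver using (module +-*-Solver)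
  open import Relation.Binary.PropositionalEquality
  open import Data.Product using (∃-syntax; _×_; _,_)
  open import Defs using (_^ℚ_)
  open ≤-Reasoning

  ι : ℕ → ℚ
  ι k = + k / 1

  -- ι k in normal form, which lets us compute with ι through the unnormalised rationals
  toℚᵘ-ι : ∀ k → toℚᵘ (ι k) ≡ U.mkℚᵘ (+ k) 0
  toℚᵘ-ι k = cong toℚᵘ (normalize-coprime (gcd≡1⇒coprime (gcd-zeroʳ k)))

  ι-+ : ∀ a b → ι (a N.+ b) ≡ ι a + ι b
  ι-+ a b = toℚᵘ-injective (UP.≃-trans (UP.≃-reflexive (toℚᵘ-ι (a N.+ b)))
    (UP.≃-trans (UP.≃-reflexive (sym unnormalised)) (UP.≃-sym (UP.≃-trans (toℚᵘ-homo-+ (ι a) (ι b))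
       (UP.≃-reflexive (cong₂ U._+_ (toℚᵘ-ι a) (toℚᵘ-ι b)))))))
    where
    unnormalised : U.mkℚᵘ (+ a) 0 U.+ U.mkℚᵘ (+ b) 0 ≡ U.mkℚᵘ (+ (a N.+ b)) 0
    unnormalised = cong (λ z → U.mkℚᵘ z 0) (cong₂ Z._+_ (ZP.*-identityʳ (+ a)) (ZP.*-identityʳ (+ b)))

  ι-* : ∀ a b → ι (a N.* b) ≡ ι a * ι b
  ι-* a b = toℚᵘ-injective (UP.≃-trans (UP.≃-reflexive (toℚᵘ-ι (a N.* b)))
    (UP.≃-trans (UP.≃-reflexive (sym unnormalised)) (UP.≃-sym (UP.≃-trans (toℚᵘ-homo-* (ι a) (ι b))
       (UP.≃-reflexive (cong₂ U._*_ (toℚᵘ-ι a) (toℚᵘ-ι b)))))))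
    where
    unnormalised : U.mkℚᵘ (+ a) 0 U.* U.mkℚᵘ (+ b) 0 ≡ U.mkℚᵘ (+ (a N.* b)) 0
    unnormalised = cong (λ z → U.mkℚᵘ z 0) (sym (ZP.pos-* a b))

  ι-mono : ∀ {a b} → a N.≤ b → ι a ≤ ι b
  ι-mono {a} {b} a≤b = toℚᵘ-cancel-≤ (subst₂ U._≤_ (sym (toℚᵘ-ι a)) (sym (toℚᵘ-ι b))
     (U.*≤* (subst₂ Z._≤_ (sym (ZP.*-identityʳ (+ a))) (sym (ZP.*-identityʳ (+ b))) (Z.+≤+ a≤b))))

  ι-suc : ∀ k → ι (suc k) ≡ 1ℚ + ι k
  ι-suc k = ι-+ 1 k

  0≤ι : ∀ k → 0ℚ ≤ ι k
  0≤ι k = ι-mono {0} {k} N.z≤n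

  0≤½ : 0ℚ ≤ ½
  0≤½ = *≤* (Z.+≤+ N.z≤n)

  ½≤1 : ½ ≤ 1ℚ
  ½≤1 = *≤* (Z.+≤+ (N.s≤s N.z≤n))

  mul-nonNeg : ∀ {p q} → 0ℚ ≤ p → 0ℚ ≤ q → 0ℚ ≤ p * q
  mul-nonNeg {p} {q} 0≤p 0≤q =
    nonNegative⁻¹ (p * q) {{nonNeg*nonNeg⇒nonNeg p {{nonNegative 0≤p}} q {{nonNegative 0≤q}}}}

  add-nonNeg : ∀ {p q} → 0ℚ ≤ p → 0ℚ ≤ q → 0ℚ ≤ p + q
  add-nonNeg = +-mono-≤

  sub-nonNeg : ∀ {x y} → x ≤ y → 0ℚ ≤ y - x
  sub-nonNeg {x} {y} x≤y = ≤-trans (≤-reflexive (sym (+-inverseʳ x))) (+-monoˡ-≤ (- x) x≤y)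

  x+d≤y⇒x≤y-d : ∀ {x d y} → x + d ≤ y → x ≤ y - d
  x+d≤y⇒x≤y-d {x} {d} {y} x+d≤y = begin
    x             ≡⟨ sym (+-identityʳ x) ⟩
    x + 0ℚ        ≡⟨ cong (λ e → x + e) (sym (+-inverseʳ d)) ⟩
    x + (d - d)   ≡⟨ sym (+-assoc x d (- d)) ⟩
    x + d - d     ≤⟨ +-monoˡ-≤ (- d) x+d≤y ⟩
    y - d         ∎

  ≤-+-nonNeg : ∀ {p q} → 0ℚ ≤ q → p ≤ p + q
  ≤-+-nonNeg {p} {q} 0≤q = ≤-trans (≤-reflexive (sym (+-identityʳ p))) (+-monoʳ-≤ p 0≤q)

  mul-monoˡ : ∀ {r p q} → 0ℚ ≤ r → p ≤ q → r * p ≤ r * q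
  mul-monoˡ {r} 0≤r = *-monoˡ-≤-nonNeg r {{nonNegative 0≤r}}

  mul-monoʳ : ∀ {r p q} → 0ℚ ≤ r → p ≤ q → p * r ≤ q * r
  mul-monoʳ {r} 0≤r = *-monoʳ-≤-nonNeg r {{nonNegative 0≤r}}

  mul-mono : ∀ {p q r s} → 0ℚ ≤ q → 0ℚ ≤ r → p ≤ q → r ≤ s → p * r ≤ q * s
  mul-mono 0≤q 0≤r p≤q r≤s = ≤-trans (mul-monoʳ 0≤r p≤q) (mul-monoˡ 0≤q r≤s)

  pow-+ : ∀ p a b → p ^ℚ (a N.+ b) ≡ p ^ℚ a * p ^ℚ b
  pow-+ p zero b = sym (*-identityˡ _)
  pow-+ p (suc a) b = trans (cong (p *_) (pow-+ p a b)) (sym (*-assoc p _ _))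

  pow-* : ∀ p a b → p ^ℚ (a N.* b) ≡ (p ^ℚ a) ^ℚ b
  pow-* p a zero rewrite NP.*-zeroʳ a = refl
  pow-* p a (suc b) rewrite NP.*-suc a b = trans (pow-+ p a (a N.* b)) (cong (p ^ℚ a *_) (pow-* p a b))

  1-pow : ∀ k → 1ℚ ^ℚ k ≡ 1ℚ
  1-pow zero = refl
  1-pow (suc k) = trans (*-identityˡ _) (1-pow k)

  mul-pow : ∀ p q k → (p * q) ^ℚ k ≡ p ^ℚ k * q ^ℚ k
  mul-pow p q zero = refl
  mul-pow p q (suc k) = trans (cong ((p * q) *_) (mul-pow p q k)) (interchange p q (p ^ℚ k) (q ^ℚ k))
    where
    open +-*-Solver
    interchange : ∀ a b c d → (a * b) * (c * d) ≡ (a * c) * (b * d)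
    interchange = solve 4 (λ a b c d → (a :* b) :* (c :* d) := (a :* c) :* (b :* d)) refl

  ι-pow : ∀ a k → ι (a N.^ k) ≡ ι a ^ℚ k
  ι-pow a zero = refl
  ι-pow a (suc k) = trans (ι-* a (a N.^ k)) (cong (ι a *_) (ι-pow a k))

  pow-nonNeg : ∀ {p} k → 0ℚ ≤ p → 0ℚ ≤ p ^ℚ k
  pow-nonNeg zero 0≤p = 0≤ι 1
  pow-nonNeg (suc k) 0≤p = mul-nonNeg 0≤p (pow-nonNeg k 0≤p)

  pow-mono : ∀ {p q} k → 0ℚ ≤ p → p ≤ q → p ^ℚ k ≤ q ^ℚ k
  pow-mono zero 0≤p p≤q = ≤-refl
  pow-mono (suc k) 0≤p p≤q =
    mul-mono (≤-trans 0≤p p≤q) (pow-nonNeg k 0≤p) p≤q (pow-mono k 0≤p p≤q)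

  pow≤1 : ∀ {p} k → 0ℚ ≤ p → p ≤ 1ℚ → p ^ℚ k ≤ 1ℚ
  pow≤1 k 0≤p p≤1 = ≤-trans (pow-mono k 0≤p p≤1) (≤-reflexive (1-pow k))

  pow≥1 : ∀ {p} k → 1ℚ ≤ p → 1ℚ ≤ p ^ℚ k
  pow≥1 zero 1≤p = ≤-refl
  pow≥1 (suc k) 1≤p = ≤-trans (≤-reflexive (sym (*-identityˡ 1ℚ)))
    (mul-mono (≤-trans (0≤ι 1) 1≤p) (0≤ι 1) 1≤p (pow≥1 k 1≤p))

  pow-antitone : ∀ {p} a b → 0ℚ ≤ p → p ≤ 1ℚ → a N.≤ b → p ^ℚ b ≤ p ^ℚ a
  pow-antitone {p} a b 0≤p p≤1 a≤b = begin
    p ^ℚ b                  ≡⟨ cong (p ^ℚ_) (sym (NP.m+[n∸m]≡n a≤b)) ⟩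
    p ^ℚ (a N.+ (b N.∸ a))  ≡⟨ pow-+ p a (b N.∸ a) ⟩
    p ^ℚ a * p ^ℚ (b N.∸ a) ≤⟨ mul-monoˡ (pow-nonNeg a 0≤p) (pow≤1 (b N.∸ a) 0≤p p≤1) ⟩
    p ^ℚ a * 1ℚ             ≡⟨ *-identityʳ _ ⟩
    p ^ℚ a                  ∎

  pow-monotone : ∀ {p} a b → 1ℚ ≤ p → a N.≤ b → p ^ℚ a ≤ p ^ℚ b
  pow-monotone {p} a b 1≤p a≤b = begin
    p ^ℚ a                  ≡⟨ sym (*-identityʳ _) ⟩
    p ^ℚ a * 1ℚ             ≤⟨ mul-monoˡ (pow-nonNeg a (≤-trans (0≤ι 1) 1≤p)) (pow≥1 (b N.∸ a) 1≤p) ⟩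
    p ^ℚ a * p ^ℚ (b N.∸ a) ≡⟨ sym (pow-+ p a (b N.∸ a)) ⟩
    p ^ℚ (a N.+ (b N.∸ a))  ≡⟨ cong (p ^ℚ_) (NP.m+[n∸m]≡n a≤b) ⟩
    p ^ℚ b                  ∎

  bernoulli⁺ : ∀ {x} k → 0ℚ ≤ x → 1ℚ + ι k * x ≤ (1ℚ + x) ^ℚ k
  bernoulli⁺ {x} zero 0≤x = ≤-reflexive (trans (cong (λ z → 1ℚ + z) (*-zeroˡ x)) (+-identityʳ 1ℚ))
  bernoulli⁺ {x} (suc k) 0≤x = begin
    1ℚ + ι (suc k) * x                   ≡⟨ cong (λ z → 1ℚ + z * x) (ι-suc k) ⟩
    1ℚ + (1ℚ + ι k) * x                  ≤⟨ ≤-+-nonNeg (mul-nonNeg (mul-nonNeg (0≤ι k) 0≤x) 0≤x) ⟩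
    1ℚ + (1ℚ + ι k) * x + ι k * x * x     ≡⟨ factor (ι k) x ⟩
    (1ℚ + x) * (1ℚ + ι k * x)            ≤⟨ mul-monoˡ (add-nonNeg (0≤ι 1) 0≤x) (bernoulli⁺ k 0≤x) ⟩
    (1ℚ + x) * (1ℚ + x) ^ℚ k             ∎
    where
    open +-*-Solver
    factor : ∀ a x → 1ℚ + (1ℚ + a) * x + a * x * x ≡ (1ℚ + x) * (1ℚ + a * x)
    factor = solve 2 (λ a x → con 1ℚ :+ (con 1ℚ :+ a) :* x :+ a :* x :* x
                             := (con 1ℚ :+ x) :* (con 1ℚ :+ a :* x)) refl

  bernoulli⁻ : ∀ {x} k → 0ℚ ≤ x → x ≤ 1ℚ → 1ℚ - ι k * x ≤ (1ℚ - x) ^ℚ k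
  bernoulli⁻ {x} zero 0≤x x≤1 = ≤-reflexive (cong (λ z → 1ℚ - z) (*-zeroˡ x))
  bernoulli⁻ {x} (suc k) 0≤x x≤1 = begin
    1ℚ - ι (suc k) * x                   ≡⟨ cong (λ z → 1ℚ - z * x) (ι-suc k) ⟩
    1ℚ - (1ℚ + ι k) * x                  ≤⟨ ≤-+-nonNeg (mul-nonNeg (mul-nonNeg (0≤ι k) 0≤x) 0≤x) ⟩
    1ℚ - (1ℚ + ι k) * x + ι k * x * x     ≡⟨ factor (ι k) x ⟩
    (1ℚ - x) * (1ℚ - ι k * x)            ≤⟨ mul-monoˡ (sub-nonNeg x≤1) (bernoulli⁻ k 0≤x x≤1) ⟩
    (1ℚ - x) * (1ℚ - x) ^ℚ k             ∎
    where
    open +-*-Solver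
    factor : ∀ a x → 1ℚ - (1ℚ + a) * x + a * x * x ≡ (1ℚ - x) * (1ℚ - a * x)
    factor = solve 2 (λ a x → con 1ℚ :- (con 1ℚ :+ a) :* x :+ a :* x :* x
                             := (con 1ℚ :- x) :* (con 1ℚ :- a :* x)) refl

  -- (1 - x)^k (1 + k x) ≤ (1 - x)^k (1 + x)^k = (1 - x²)^k ≤ 1
  pow-times-bernoulli≤1 : ∀ {x} k → 0ℚ ≤ x → x ≤ 1ℚ → (1ℚ - x) ^ℚ k * (1ℚ + ι k * x) ≤ 1ℚ
  pow-times-bernoulli≤1 {x} k 0≤x x≤1 = begin
    (1ℚ - x) ^ℚ k * (1ℚ + ι k * x) ≤⟨ mul-monoˡ (pow-nonNeg k (sub-nonNeg x≤1)) (bernoulli⁺ k 0≤x) ⟩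
    (1ℚ - x) ^ℚ k * (1ℚ + x) ^ℚ k  ≡⟨ sym (mul-pow _ _ k) ⟩
    ((1ℚ - x) * (1ℚ + x)) ^ℚ k     ≡⟨ cong (_^ℚ k) (difference-of-squares x) ⟩
    (1ℚ - x * x) ^ℚ k              ≤⟨ pow≤1 k (sub-nonNeg x²≤1) 1-x²≤1 ⟩
    1ℚ                             ∎
    where
    open +-*-Solver
    difference-of-squares : ∀ x → (1ℚ - x) * (1ℚ + x) ≡ 1ℚ - x * x
    difference-of-squares = solve 1 (λ x → (con 1ℚ :- x) :* (con 1ℚ :+ x) := con 1ℚ :- x :* x) refl
    x²≤1 : x * x ≤ 1ℚ
    x²≤1 = mul-mono (≤-trans 0≤x x≤1) 0≤x x≤1 x≤1
    1-x²≤1 : 1ℚ - x * x ≤ 1ℚ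
    1-x²≤1 = +-monoʳ-≤ 1ℚ (neg-antimono-≤ (mul-nonNeg 0≤x 0≤x))

  halving : ∀ {x} m → 0ℚ ≤ x → x ≤ 1ℚ → 1ℚ ≤ ι m * x → (1ℚ - x) ^ℚ m ≤ ½
  halving {x} m 0≤x x≤1 1≤mx = begin
    P                            ≡⟨ sym (*-identityʳ P) ⟩
    P * ((1ℚ + 1ℚ) * ½)          ≡⟨ sym (*-assoc P _ _) ⟩
    P * (1ℚ + 1ℚ) * ½            ≤⟨ mul-monoʳ 0≤½ (mul-monoˡ (pow-nonNeg m (sub-nonNeg x≤1)) (+-monoʳ-≤ 1ℚ 1≤mx)) ⟩
    P * (1ℚ + ι m * x) * ½       ≤⟨ mul-monoʳ 0≤½ (pow-times-bernoulli≤1 m 0≤x x≤1) ⟩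
    1ℚ * ½                       ≡⟨ *-identityˡ ½ ⟩
    ½                            ∎
    where
    P = (1ℚ - x) ^ℚ m

  halving-pow : ∀ {x} m r → 0ℚ ≤ x → x ≤ 1ℚ → 1ℚ ≤ ι m * x → (1ℚ - x) ^ℚ (m N.* r) ≤ ½ ^ℚ r
  halving-pow {x} m r 0≤x x≤1 1≤mx = ≤-trans (≤-reflexive (pow-* _ m r))
    (pow-mono r (pow-nonNeg m (sub-nonNeg x≤1)) (halving m 0≤x x≤1 1≤mx))

  ½ⁿ*2ⁿ≡1 : ∀ r → ½ ^ℚ r * ι 2 ^ℚ r ≡ 1ℚ
  ½ⁿ*2ⁿ≡1 r = trans (sym (mul-pow ½ (ι 2) r)) (1-pow r)

  1/n*n≡1 : ∀ n .{{_ : NonZero n}} → (+ 1 / n) * ι n ≡ 1ℚ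
  1/n*n≡1 (suc m) = toℚᵘ-injective (UP.≃-trans (toℚᵘ-homo-* (+ 1 / suc m) (ι (suc m)))
     (UP.≃-trans (UP.≃-reflexive (cong₂ U._*_ 1/n-normal (toℚᵘ-ι (suc m)))) (U.*≡* cross)))
    where
    1/n-normal : toℚᵘ (+ 1 / suc m) ≡ U.mkℚᵘ (+ 1) m
    1/n-normal = cong toℚᵘ (normalize-coprime (1-coprimeTo (suc m)))
    cross : U.↥ (U.mkℚᵘ (+ 1) m U.* U.mkℚᵘ (+ suc m) 0) Z.* U.↧ U.1ℚᵘ
          ≡ U.↥ U.1ℚᵘ Z.* U.↧ (U.mkℚᵘ (+ 1) m U.* U.mkℚᵘ (+ suc m) 0)
    cross = cong (λ t → + suc t) (trans (NP.*-identityʳ (m N.+ 0))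
              (trans (NP.+-identityʳ m) (sym (trans (NP.+-identityʳ (m N.* 1)) (NP.*-identityʳ m)))))

  0≤1/n : ∀ n .{{_ : NonZero n}} → 0ℚ ≤ + 1 / n
  0≤1/n n = nonNegative⁻¹ (+ 1 / n) {{normalize-nonNeg 1 n}}

  1/n≤1 : ∀ n .{{_ : NonZero n}} → + 1 / n ≤ 1ℚ
  1/n≤1 n = begin
    + 1 / n          ≡⟨ sym (*-identityʳ _) ⟩
    (+ 1 / n) * 1ℚ   ≤⟨ mul-monoˡ (0≤1/n n) (ι-mono (N.>-nonZero⁻¹ n)) ⟩
    (+ 1 / n) * ι n  ≡⟨ 1/n*n≡1 n ⟩
    1ℚ               ∎

  0≤1-1/n : ∀ n .{{_ : NonZero n}} → 0ℚ ≤ 1ℚ - + 1 / n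
  0≤1-1/n n = sub-nonNeg (1/n≤1 n)

  1-1/n≤1 : ∀ n .{{_ : NonZero n}} → 1ℚ - + 1 / n ≤ 1ℚ
  1-1/n≤1 n = +-monoʳ-≤ 1ℚ (neg-antimono-≤ (0≤1/n n))

  archimedean : ∀ (c : ℚ) → 0ℚ < c → ∃[ A ] (1 N.≤ A × 1ℚ ≤ c * ι A)
  archimedean (mkℚ (+ zero) d _) (*<* (Z.+<+ ()))
  archimedean (mkℚ (Z.-[1+ k ]) d _) (*<* ())
  archimedean c@(mkℚ (+ suc k) d _) 0<c =
    suc d , N.s≤s N.z≤n , ≤-trans (ι-mono {1} {suc k} (N.s≤s N.z≤n)) (≤-reflexive (sym c*[d+1]≡k+1))
    where
    module NS = Data.Nat.Solver.+-*-Solver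
    cross : U.↥ (toℚᵘ c U.* U.mkℚᵘ (+ suc d) 0) Z.* U.↧ (U.mkℚᵘ (+ suc k) 0)
          ≡ U.↥ (U.mkℚᵘ (+ suc k) 0) Z.* U.↧ (toℚᵘ c U.* U.mkℚᵘ (+ suc d) 0)
    cross = cong (λ t → + suc t) (NS.solve 2 (λ d k →
      (d NS.:+ k NS.:* (NS.con 1 NS.:+ d)) NS.:* NS.con 1
        NS.:= d NS.:* NS.con 1 NS.:+ k NS.:* (NS.con 1 NS.:+ d NS.:* NS.con 1)) refl d k)
    c*[d+1]≡k+1 : c * ι (suc d) ≡ ι (suc k)
    c*[d+1]≡k+1 = toℚᵘ-injective (UP.≃-trans (toℚᵘ-homo-* c (ι (suc d)))
      (UP.≃-trans (UP.≃-reflexive (cong (U._*_ (toℚᵘ c)) (toℚᵘ-ι (suc d))))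
      (UP.≃-trans (U.*≡* cross) (UP.≃-reflexive (sym (toℚᵘ-ι (suc k)))))))


module FiniteSums where

  open import Data.Nat using (ℕ; zero; suc)
  import Data.Nat as N
  import Data.Nat.Properties as NP
  open import Data.Fin using (Fin)
  import Data.Fin as F
  open import Data.Vec using (Vec; []; _∷_)
  open import Data.List using (List; []; _∷_; map; _++_; concatMap; downFrom)
  open import Data.Bool using (Bool; true; false; _∧_; not)
  open import Data.Sum using (_⊎_; inj₁; inj₂)
  open import Data.Rational hiding (truncate)
  open import Data.Rational.Properties
  open import Data.Rational.Solver using (module +-*-Solver)
  open import Relation.Binary.PropositionalEquality hiding ([_])
  open import Function using (_∘_)
  open import Defs
  open RationalArith
  open ≤-Reasoning

  S : {A : Set} → (A → ℚ) → List A → ℚ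
  S f xs = Σℚ (map f xs)

  S-cong : {A : Set} {f g : A → ℚ} (xs : List A) → (∀ a → f a ≡ g a) → S f xs ≡ S g xs
  S-cong [] f≡g = refl
  S-cong (x ∷ xs) f≡g = cong₂ _+_ (f≡g x) (S-cong xs f≡g)

  S-mono : {A : Set} {f g : A → ℚ} (xs : List A) → (∀ a → f a ≤ g a) → S f xs ≤ S g xs
  S-mono [] f≤g = ≤-refl
  S-mono (x ∷ xs) f≤g = +-mono-≤ (f≤g x) (S-mono xs f≤g)

  S-nonNeg : {A : Set} {f : A → ℚ} (xs : List A) → (∀ a → 0ℚ ≤ f a) → 0ℚ ≤ S f xs
  S-nonNeg [] 0≤f = ≤-refl
  S-nonNeg (x ∷ xs) 0≤f = add-nonNeg (0≤f x) (S-nonNeg xs 0≤f)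

  S-0 : {A : Set} (xs : List A) → S (λ _ → 0ℚ) xs ≡ 0ℚ
  S-0 [] = refl
  S-0 (x ∷ xs) = trans (+-identityˡ _) (S-0 xs)

  S-++ : {A : Set} (f : A → ℚ) (xs ys : List A) → S f (xs ++ ys) ≡ S f xs + S f ys
  S-++ f [] ys = sym (+-identityˡ _)
  S-++ f (x ∷ xs) ys = trans (cong (f x +_) (S-++ f xs ys)) (sym (+-assoc (f x) _ _))

  S-map : {A B : Set} (f : B → ℚ) (g : A → B) (xs : List A) → S f (map g xs) ≡ S (f ∘ g) xs
  S-map f g [] = refl
  S-map f g (x ∷ xs) = cong (f (g x) +_) (S-map f g xs)

  S-concatMap : {A B : Set} (f : B → ℚ) (g : A → List B) (xs : List A) →
    S f (concatMap g xs) ≡ S (λ a → S f (g a)) xs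
  S-concatMap f g [] = refl
  S-concatMap f g (x ∷ xs) =
    trans (S-++ f (g x) (concatMap g xs)) (cong (S f (g x) +_) (S-concatMap f g xs))

  S-*ˡ : {A : Set} (c : ℚ) (f : A → ℚ) (xs : List A) → S (λ a → c * f a) xs ≡ c * S f xs
  S-*ˡ c f [] = sym (*-zeroʳ c)
  S-*ˡ c f (x ∷ xs) = trans (cong (c * f x +_) (S-*ˡ c f xs)) (sym (*-distribˡ-+ c (f x) _))

  S-*ʳ : {A : Set} (c : ℚ) (f : A → ℚ) (xs : List A) → S (λ a → f a * c) xs ≡ S f xs * c
  S-*ʳ c f xs = trans (S-cong xs (λ a → *-comm (f a) c)) (trans (S-*ˡ c f xs) (*-comm c _))

  S-+ : {A : Set} (f g : A → ℚ) (xs : List A) → S (λ a → f a + g a) xs ≡ S f xs + S g xs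
  S-+ f g [] = refl
  S-+ f g (x ∷ xs) = trans (cong (f x + g x +_) (S-+ f g xs)) (medial (f x) (g x) (S f xs) (S g xs))
    where
    open +-*-Solver
    medial : ∀ a b c d → a + b + (c + d) ≡ a + c + (b + d)
    medial = solve 4 (λ a b c d → a :+ b :+ (c :+ d) := a :+ c :+ (b :+ d)) refl

  S-swap : {A B : Set} (f : A → B → ℚ) (xs : List A) (ys : List B) →
    S (λ a → S (λ b → f a b) ys) xs ≡ S (λ b → S (λ a → f a b) xs) ys
  S-swap f [] ys = sym (S-0 ys)
  S-swap f (x ∷ xs) ys = trans (cong (S (λ b → f x b) ys +_) (S-swap f xs ys))
    (sym (S-+ (λ b → f x b) (λ b → S (λ a → f a b) xs) ys))

  S-const : ∀ (c : ℚ) k → S (λ _ → c) (downFrom k) ≡ ι k * c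
  S-const c zero = sym (*-zeroˡ c)
  S-const c (suc k) =
    trans (cong (c +_) (S-const c k)) (trans (factor c (ι k)) (cong (_* c) (sym (ι-suc k))))
    where
    open +-*-Solver
    factor : ∀ c k → c + k * c ≡ (1ℚ + k) * c
    factor = solve 2 (λ c k → c :+ k :* c := (con 1ℚ :+ k) :* c) refl

  []-nonNeg : ∀ b → 0ℚ ≤ [ b ]
  []-nonNeg false = ≤-refl
  []-nonNeg true = 0≤ι 1

  []-≤1 : ∀ b → [ b ] ≤ 1ℚ
  []-≤1 false = 0≤ι 1
  []-≤1 true = ≤-refl

  []-∧ : ∀ b c → [ b ∧ c ] ≤ [ b ]
  []-∧ false c = ≤-refl
  []-∧ true c = []-≤1 c

  []-not : ∀ b → [ b ] + [ not b ] ≡ 1ℚ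
  []-not true = refl
  []-not false = refl

  nowhere-or-counted : ∀ (f : ℕ → Bool) k →
    (∀ s → s N.< k → f s ≡ false) ⊎ (1ℚ ≤ S (λ s → [ f s ]) (downFrom k))
  nowhere-or-counted f zero = inj₁ (λ s ())
  nowhere-or-counted f (suc k) with f k in fk
  ... | true = inj₂ (≤-+-nonNeg (S-nonNeg (downFrom k) (λ s → []-nonNeg (f s))))
  ... | false with nowhere-or-counted f k
  ...   | inj₂ counted = inj₂ (≤-trans counted (≤-reflexive (sym (+-identityˡ _))))
  ...   | inj₁ nowhere = inj₁ (λ s s<1+k → below-or-at s (NP.m<1+n⇒m<n∨m≡n s<1+k))
    where
    below-or-at : ∀ s → s N.< k ⊎ s ≡ k → f s ≡ false
    below-or-at s (inj₁ s<k) = nowhere s s<k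
    below-or-at s (inj₂ refl) = fk

  Π : (k : ℕ) → (Fin k → ℚ) → ℚ
  Π zero g = 1ℚ
  Π (suc k) g = g F.zero * Π k (g ∘ F.suc)

  Π-nonNeg : ∀ k (g : Fin k → ℚ) → (∀ j → 0ℚ ≤ g j) → 0ℚ ≤ Π k g
  Π-nonNeg zero g 0≤g = 0≤ι 1
  Π-nonNeg (suc k) g 0≤g = mul-nonNeg (0≤g F.zero) (Π-nonNeg k (g ∘ F.suc) (0≤g ∘ F.suc))

  Π-≡1 : ∀ k (g : Fin k → ℚ) → (∀ j → g j ≡ 1ℚ) → Π k g ≡ 1ℚ
  Π-≡1 zero g g≡1 = refl
  Π-≡1 (suc k) g g≡1 = trans (cong₂ _*_ (g≡1 F.zero) (Π-≡1 k (g ∘ F.suc) (g≡1 ∘ F.suc))) (*-identityˡ 1ℚ)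

  Π-≤-pow : ∀ k (g : Fin k → ℚ) r → (∀ j → 0ℚ ≤ g j) → (∀ j → g j ≤ r) → Π k g ≤ r ^ℚ k
  Π-≤-pow zero g r 0≤g g≤r = ≤-refl
  Π-≤-pow (suc k) g r 0≤g g≤r = mul-mono (≤-trans (0≤g F.zero) (g≤r F.zero)) (Π-nonNeg k (g ∘ F.suc) (0≤g ∘ F.suc))
    (g≤r F.zero) (Π-≤-pow k (g ∘ F.suc) r (0≤g ∘ F.suc) (g≤r ∘ F.suc))

  prodV : {A : Set} {k : ℕ} → (Fin k → A → ℚ) → Vec A k → ℚ
  prodV f [] = 1ℚ
  prodV f (a ∷ v) = f F.zero a * prodV (f ∘ F.suc) v

  prodV-nonNeg : ∀ {A : Set} {k} (f : Fin k → A → ℚ) → (∀ j a → 0ℚ ≤ f j a) → (v : Vec A k) → 0ℚ ≤ prodV f v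
  prodV-nonNeg f 0≤f [] = 0≤ι 1
  prodV-nonNeg f 0≤f (a ∷ v) = mul-nonNeg (0≤f F.zero a) (prodV-nonNeg (f ∘ F.suc) (0≤f ∘ F.suc) v)

  prodV-* : ∀ {A : Set} {k} (f g : Fin k → A → ℚ) (v : Vec A k) →
    prodV f v * prodV g v ≡ prodV (λ j a → f j a * g j a) v
  prodV-* f g [] = refl
  prodV-* f g (a ∷ v) =
    trans (interchange (f F.zero a) (prodV (f ∘ F.suc) v) (g F.zero a) (prodV (g ∘ F.suc) v))
      (cong ((f F.zero a * g F.zero a) *_) (prodV-* (f ∘ F.suc) (g ∘ F.suc) v))
    where
    open +-*-Solver
    interchange : ∀ a b c d → (a * b) * (c * d) ≡ (a * c) * (b * d)
    interchange = solve 4 (λ a b c d → (a :* b) :* (c :* d) := (a :* c) :* (b :* d)) refl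

  S-prodV : {A : Set} (xs : List A) (k : ℕ) (f : Fin k → A → ℚ) →
    S (prodV f) (allVec xs k) ≡ Π k (λ j → S (f j) xs)
  S-prodV xs zero f = +-identityʳ 1ℚ
  S-prodV xs (suc k) f = begin-equality
    S (prodV f) (concatMap (λ a → map (a ∷_) (allVec xs k)) xs)
      ≡⟨ S-concatMap (prodV f) _ xs ⟩
    S (λ a → S (prodV f) (map (a ∷_) (allVec xs k))) xs
      ≡⟨ S-cong xs (λ a → S-map (prodV f) (a ∷_) (allVec xs k)) ⟩
    S (λ a → S (λ v → f F.zero a * prodV (f ∘ F.suc) v) (allVec xs k)) xs
      ≡⟨ S-cong xs (λ a → S-*ˡ (f F.zero a) _ (allVec xs k)) ⟩
    S (λ a → f F.zero a * S (prodV (f ∘ F.suc)) (allVec xs k)) xs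
      ≡⟨ S-*ʳ _ (f F.zero) xs ⟩
    S (f F.zero) xs * S (prodV (f ∘ F.suc)) (allVec xs k)
      ≡⟨ cong (S (f F.zero) xs *_) (S-prodV xs k (f ∘ F.suc)) ⟩
    S (f F.zero) xs * Π k (λ j → S (f (F.suc j)) xs) ∎


module BitVectors where

  open import Data.Nat using (ℕ; zero; suc; _∸_)
  import Data.Nat as N
  import Data.Nat.Properties as NP
  open import Data.Fin using (Fin)
  import Data.Fin as F
  open import Data.Vec using ([]; _∷_; lookup)
  open import Data.List using ([]; _∷_; map)
  open import Data.Bool using (Bool; true; false; _∧_; if_then_else_; _xor_; not)
  import Data.Bool as B
  open import Data.Vec.Properties using (≡-dec)
  open import Data.Empty using (⊥-elim)
  open import Data.Rational hiding (truncate)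
  open import Data.Rational.Properties
  open import Data.Rational.Solver using (module +-*-Solver)
  open import Relation.Binary.PropositionalEquality hiding ([_])
  open import Relation.Nullary using (yes; no)
  open import Relation.Nullary.Decidable.Core using (Dec; isYes; does; _because_)
  open import Function using (_∘_)
  open import Defs
  open RationalArith
  open FiniteSums
  open ≤-Reasoning

  isYes≡does : ∀ {A : Set} (d : Dec A) → isYes d ≡ does d
  isYes≡does (true because _) = refl
  isYes≡does (false because _) = refl

  ==-∷ : ∀ {k} (b a : Bool) (w y : Bits k) → ((b ∷ w) == (a ∷ y)) ≡ (isYes (b B.≟ a) ∧ (w == y))
  ==-∷ b a w y = trans (isYes≡does (≡-dec B._≟_ (b ∷ w) (a ∷ y)))
    (cong₂ _∧_ (sym (isYes≡does (b B.≟ a))) (sym (isYes≡does (≡-dec B._≟_ w y))))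

  ==-sym : ∀ {k} (x y : Bits k) → (x == y) ≡ (y == x)
  ==-sym x y with ≡-dec B._≟_ x y | ≡-dec B._≟_ y x
  ... | yes _ | yes _ = refl
  ... | no _ | no _ = refl
  ... | yes x≡y | no y≢x = ⊥-elim (y≢x (sym x≡y))
  ... | no x≢y | yes y≡x = ⊥-elim (x≢y (sym y≡x))

  S-indicator : (k : ℕ) (w : Bits k) (h : Bits k → ℚ) → S (λ y → h y * [ w == y ]) (allBits k) ≡ h w
  S-indicator zero [] h = trans (+-identityʳ _) (*-identityʳ _)
  S-indicator (suc k) (b ∷ w) h = begin-equality
    S (λ y → h y * [ (b ∷ w) == y ]) (allBits (suc k))
      ≡⟨ S-concatMap (λ y → h y * [ (b ∷ w) == y ]) (λ a → map (a ∷_) (allBits k)) (false ∷ true ∷ []) ⟩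
    S (λ a → S (λ y → h y * [ (b ∷ w) == y ]) (map (a ∷_) (allBits k))) (false ∷ true ∷ [])
      ≡⟨ S-cong (false ∷ true ∷ []) (λ a → S-map (λ y → h y * [ (b ∷ w) == y ]) (a ∷_) (allBits k)) ⟩
    S (λ a → S (λ y → h (a ∷ y) * [ (b ∷ w) == (a ∷ y) ]) (allBits k)) (false ∷ true ∷ [])
      ≡⟨ by-first-bit b ⟩
    h (b ∷ w) ∎
    where
    head-split : ∀ b a y → h (a ∷ y) * [ (b ∷ w) == (a ∷ y) ] ≡ h (a ∷ y) * [ isYes (b B.≟ a) ∧ (w == y) ]
    head-split b a y = cong (λ t → h (a ∷ y) * [ t ]) (==-∷ b a w y)
    other-head : ∀ b a → isYes (b B.≟ a) ≡ false →
      S (λ y → h (a ∷ y) * [ (b ∷ w) == (a ∷ y) ]) (allBits k) ≡ 0ℚ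
    other-head b a b≢a = trans (S-cong (allBits k) (λ y → trans (head-split b a y)
      (trans (cong (λ t → h (a ∷ y) * [ t ∧ (w == y) ]) b≢a) (*-zeroʳ (h (a ∷ y)))))) (S-0 (allBits k))
    same-head : ∀ a → S (λ y → h (a ∷ y) * [ (a ∷ w) == (a ∷ y) ]) (allBits k) ≡ h (a ∷ w)
    same-head false = trans (S-cong (allBits k) (head-split false false)) (S-indicator k w (h ∘ (false ∷_)))
    same-head true = trans (S-cong (allBits k) (head-split true true)) (S-indicator k w (h ∘ (true ∷_)))
    by-first-bit : ∀ b → S (λ a → S (λ y → h (a ∷ y) * [ (b ∷ w) == (a ∷ y) ]) (allBits k)) (false ∷ true ∷ [])
                         ≡ h (b ∷ w)
    by-first-bit false = trans (cong₂ _+_ (same-head false) (cong (_+ 0ℚ) (other-head false true refl))) (+-identityʳ _)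
    by-first-bit true = trans (cong₂ _+_ (other-head true false refl) (trans (+-identityʳ _) (same-head true)))
                          (+-identityˡ _)

  S-point-mass : ∀ {k} (w : Bits k) → S (λ y → [ w == y ]) (allBits k) ≡ 1ℚ
  S-point-mass {k} w = trans (S-cong (allBits k) (λ y → sym (*-identityˡ [ w == y ]))) (S-indicator k w (λ _ → 1ℚ))

  hamming≤length : ∀ {k} (x z : Bits k) → hamming x z N.≤ k
  hamming≤length [] [] = N.z≤n
  hamming≤length (a ∷ x) (b ∷ z) with a xor b
  ... | true = N.s≤s (hamming≤length x z)
  ... | false = NP.m≤n⇒m≤1+n (hamming≤length x z)

  bitWeight : ∀ {k} → ℚ → ℚ → Bits k → Fin k → Bool → ℚ
  bitWeight q r x j b = if lookup x j xor b then q else r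

  mutation-weight-product : ∀ {k} (q r : ℚ) (x z : Bits k) →
    q ^ℚ hamming x z * r ^ℚ (k ∸ hamming x z) ≡ prodV (bitWeight q r x) z
  mutation-weight-product q r [] [] = refl
  mutation-weight-product {suc k} q r (a ∷ x) (b ∷ z) with a xor b
  ... | true = trans (*-assoc q _ _) (cong (q *_) (mutation-weight-product q r x z))
  ... | false = begin-equality
    q ^ℚ hamming x z * r ^ℚ (suc k ∸ hamming x z)
      ≡⟨ cong (λ e → q ^ℚ hamming x z * r ^ℚ e) (NP.+-∸-assoc 1 (hamming≤length x z)) ⟩
    q ^ℚ hamming x z * (r * r ^ℚ (k ∸ hamming x z))
      ≡⟨ swap-front (q ^ℚ hamming x z) r _ ⟩
    r * (q ^ℚ hamming x z * r ^ℚ (k ∸ hamming x z))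
      ≡⟨ cong (r *_) (mutation-weight-product q r x z) ⟩
    r * prodV (bitWeight q r (a ∷ x) ∘ F.suc) z ∎
    where
    open +-*-Solver
    swap-front : ∀ a b c → a * (b * c) ≡ b * (a * c)
    swap-front = solve 3 (λ a b c → a :* (b :* c) := b :* (a :* c)) refl

  mutation-weights-sum-to-1 : ∀ k (q r : ℚ) (x : Bits k) → q + r ≡ 1ℚ →
    S (λ z → q ^ℚ hamming x z * r ^ℚ (k ∸ hamming x z)) (allBits k) ≡ 1ℚ
  mutation-weights-sum-to-1 k q r x q+r≡1 = trans (S-cong (allBits k) (mutation-weight-product q r x))
    (trans (S-prodV _ k (bitWeight q r x)) (Π-≡1 k _ per-bit))
    where
    per-bit : ∀ j → S (bitWeight q r x j) (false ∷ true ∷ []) ≡ 1ℚ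
    per-bit j with lookup x j
    ... | false = trans (cong (r +_) (+-identityʳ q)) (trans (+-comm r q) q+r≡1)
    ... | true = trans (cong (q +_) (+-identityʳ r)) q+r≡1

  flip : ∀ {k} → Bits k → Fin k → Bits k
  flip (a ∷ x) F.zero = not a ∷ x
  flip (a ∷ x) (F.suc j) = a ∷ flip x j

  flip-other : ∀ {k} (x : Bits k) j i → i ≢ j → lookup (flip x j) i ≡ lookup x i
  flip-other (a ∷ x) F.zero F.zero i≢j = ⊥-elim (i≢j refl)
  flip-other (a ∷ x) F.zero (F.suc i) i≢j = refl
  flip-other (a ∷ x) (F.suc j) F.zero i≢j = refl
  flip-other (a ∷ x) (F.suc j) (F.suc i) i≢j = flip-other x j i (i≢j ∘ cong F.suc)

  hamming-self : ∀ {k} (x : Bits k) → hamming x x ≡ 0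
  hamming-self [] = refl
  hamming-self (false ∷ x) = hamming-self x
  hamming-self (true ∷ x) = hamming-self x

  hamming-flip : ∀ {k} (x : Bits k) j → hamming x (flip x j) ≡ 1
  hamming-flip (false ∷ x) F.zero = cong suc (hamming-self x)
  hamming-flip (true ∷ x) F.zero = cong suc (hamming-self x)
  hamming-flip (false ∷ x) (F.suc j) = hamming-flip x j
  hamming-flip (true ∷ x) (F.suc j) = hamming-flip x j

  hamming-triangle : ∀ {k} (x y z : Bits k) → hamming x z N.≤ hamming x y N.+ hamming y z
  hamming-triangle [] [] [] = N.z≤n
  hamming-triangle (a ∷ x) (b ∷ y) (c ∷ z) = per-bit a b c (hamming-triangle x y z)
    where
    d : Bool → Bool → ℕ
    d a b = if a xor b then 1 else 0
    both : ∀ {h₂ h₃} e₁ e₂ → h₂ N.+ h₃ N.≤ (e₁ N.+ h₂) N.+ (e₂ N.+ h₃)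
    both {h₂} {h₃} e₁ e₂ = NP.+-mono-≤ (NP.m≤n+m h₂ e₁) (NP.m≤n+m h₃ e₂)
    per-bit : ∀ a b c {h₁ h₂ h₃} → h₁ N.≤ h₂ N.+ h₃ → d a c N.+ h₁ N.≤ (d a b N.+ h₂) N.+ (d b c N.+ h₃)
    per-bit false false false le = le
    per-bit false false true {h₁} {h₂} {h₃} le = subst (1 N.+ h₁ N.≤_) (sym (NP.+-suc h₂ h₃)) (N.s≤s le)
    per-bit false true false le = NP.≤-trans le (both 1 1)
    per-bit false true true le = N.s≤s le
    per-bit true false false le = N.s≤s le
    per-bit true false true le = NP.≤-trans le (both 1 1)
    per-bit true true false {h₁} {h₂} {h₃} le = subst (1 N.+ h₁ N.≤_) (sym (NP.+-suc h₂ h₃)) (N.s≤s le)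
    per-bit true true true le = le

  S-one-smaller : ∀ {k} (f c : Bits k → ℚ) (z₀ : Bits k) (δ : ℚ) →
    (∀ z → f z ≤ c z) → f z₀ + δ ≤ c z₀ → S f (allBits k) + δ ≤ S c (allBits k)
  S-one-smaller {k} f c z₀ δ f≤c at-z₀ = begin
    S f A + δ                             ≡⟨ cong (λ e → S f A + e) (sym (trans (cong (δ *_) (S-point-mass z₀)) (*-identityʳ δ))) ⟩
    S f A + δ * S (λ z → [ z₀ == z ]) A    ≡⟨ cong (λ e → S f A + e) (sym (S-*ˡ δ _ A)) ⟩
    S f A + S (λ z → δ * [ z₀ == z ]) A    ≡⟨ sym (S-+ f _ A) ⟩
    S (λ z → f z + δ * [ z₀ == z ]) A      ≤⟨ S-mono A pointwise ⟩
    S c A                                 ∎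
    where
    A = allBits k
    pointwise : ∀ z → f z + δ * [ z₀ == z ] ≤ c z
    pointwise z with ≡-dec B._≟_ z₀ z
    ... | yes refl = ≤-trans (≤-reflexive (cong (λ e → f z₀ + e) (*-identityʳ δ))) at-z₀
    ... | no _ = ≤-trans (≤-reflexive (trans (cong (λ e → f z + e) (*-zeroʳ δ)) (+-identityʳ _))) (f≤c z)


module Improvement where

  -- Call an instance B-dense when
  -- every window [s, s+B) of size indices inside [0, n) contains the size of some job.  On a
  -- B-dense instance every solution of discrepancy > B can be turned into one of strictly
  -- smaller makespan by flipping at most two bits: either a job moves from the fuller machine
  -- to the emptier one, or it is swapped with a job that is at most B smaller.

  open import Data.Nat
  open import Data.Nat.Properties
  open import Data.Fin using (Fin; toℕ)
  import Data.Fin as F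
  import Data.Fin.Properties as FP
  open import Data.Vec using (Vec; []; _∷_; lookup; zipWith)
  open import Data.Bool using (Bool; true; false; if_then_else_; _xor_; not)
  import Data.Bool as B
  open import Data.Product using (∃-syntax; _×_; _,_)
  open import Data.Sum using (_⊎_; inj₁; inj₂)
  open import Data.Empty using (⊥-elim)
  open import Relation.Nullary using (¬_; yes; no)
  open import Relation.Binary.PropositionalEquality
  open import Defs
  open BitVectors using (flip; flip-other; hamming-flip; hamming-triangle)

  load : ∀ {m k} → Bool → Vec (Fin m) k → Bits k → ℕ
  load α [] [] = 0
  load α (s ∷ p) (b ∷ x) = (if b xor α then 0 else size s) + load α p x

  load₁≡load : ∀ {m k} (p : Vec (Fin m) k) (x : Bits k) →
    sumℕ (zipWith (λ s b → if b then 0 else size s) p x) ≡ load false p x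
  load₁≡load [] [] = refl
  load₁≡load (s ∷ p) (false ∷ x) = cong (size s +_) (load₁≡load p x)
  load₁≡load (s ∷ p) (true ∷ x) = load₁≡load p x

  load₂≡load : ∀ {m k} (p : Vec (Fin m) k) (x : Bits k) →
    sumℕ (zipWith (λ s b → if b then size s else 0) p x) ≡ load true p x
  load₂≡load [] [] = refl
  load₂≡load (s ∷ p) (false ∷ x) = load₂≡load p x
  load₂≡load (s ∷ p) (true ∷ x) = cong (size s +_) (load₂≡load p x)

  makespan≡ : ∀ {n} (p : Instance n) (x : Bits n) → makespan p x ≡ load false p x ⊔ load true p x
  makespan≡ p x = cong₂ _⊔_ (load₁≡load p x) (load₂≡load p x)

  discrepancy≡ : ∀ {n} (p : Instance n) (x : Bits n) → discrepancy p x ≡ ∣ load false p x - load true p x ∣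
  discrepancy≡ p x = cong₂ ∣_-_∣ (load₁≡load p x) (load₂≡load p x)

  flip-leaves : ∀ {m k} α (p : Vec (Fin m) k) (x : Bits k) j → lookup x j ≡ α →
    load α p x ≡ load α p (flip x j) + size (lookup p j)
  flip-leaves false (s ∷ p) (false ∷ x) F.zero _ = +-comm (size s) _
  flip-leaves true (s ∷ p) (true ∷ x) F.zero _ = +-comm (size s) _
  flip-leaves false (s ∷ p) (true ∷ x) F.zero ()
  flip-leaves true (s ∷ p) (false ∷ x) F.zero ()
  flip-leaves α (s ∷ p) (b ∷ x) (F.suc j) e =
    trans (cong ((if b xor α then 0 else size s) +_) (flip-leaves α p x j e))
          (sym (+-assoc (if b xor α then 0 else size s) _ _))

  flip-arrives : ∀ {m k} α (p : Vec (Fin m) k) (x : Bits k) j → lookup x j ≡ α →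
    load (not α) p (flip x j) ≡ load (not α) p x + size (lookup p j)
  flip-arrives false (s ∷ p) (false ∷ x) F.zero _ = +-comm (size s) _
  flip-arrives true (s ∷ p) (true ∷ x) F.zero _ = +-comm (size s) _
  flip-arrives false (s ∷ p) (true ∷ x) F.zero ()
  flip-arrives true (s ∷ p) (false ∷ x) F.zero ()
  flip-arrives α (s ∷ p) (b ∷ x) (F.suc j) e =
    trans (cong ((if b xor not α then 0 else size s) +_) (flip-arrives α p x j e))
          (sym (+-assoc (if b xor not α then 0 else size s) _ _))

  job-on : ∀ {m k} α (p : Vec (Fin m) k) (x : Bits k) → 0 < load α p x → ∃[ a ] lookup x a ≡ α
  job-on α [] [] ()
  job-on α (s ∷ p) (b ∷ x) pos with b xor α in b⊕α
  ... | false = F.zero , xor-false b⊕α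
    where
    xor-false : ∀ {b α} → b xor α ≡ false → b ≡ α
    xor-false {false} {false} _ = refl
    xor-false {true} {true} _ = refl
  ... | true with job-on α p x pos
  ...   | a , e = F.suc a , e

  Dense : ∀ {m k} → ℕ → Vec (Fin m) k → Set
  Dense {m} B p = ∀ s → s + B ≤ m → ∃[ j ] (s ≤ toℕ (lookup p j) × toℕ (lookup p j) < s + B)

  Rebalance : ∀ {m k} → Vec (Fin m) k → Bool → Bits k → Set
  Rebalance p α x = ∃[ z ] (hamming x z ≤ 2 × load α p z < load α p x × load (not α) p z < load α p x)

  module _ {m k} (B : ℕ) (p : Vec (Fin m) k) (α : Bool) (x : Bits k) where

    private
      A O : ℕ
      A = load α p x
      O = load (not α) p x
      t : Fin k → ℕ
      t j = toℕ (lookup p j)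

    single-move : ∀ a → lookup x a ≡ α → size (lookup p a) + O < A → Rebalance p α x
    single-move a xa≡α small = flip x a , ≤-trans (≤-reflexive (hamming-flip x a)) (s≤s z≤n)
      , lighter , subst (_< A) (trans (+-comm _ O) (sym (flip-arrives α p x a xa≡α))) small
      where
      lighter : load α p (flip x a) < A
      lighter = subst (load α p (flip x a) <_) (sym (flip-leaves α p x a xa≡α))
        (subst (_< load α p (flip x a) + size (lookup p a)) (+-identityʳ _) (+-monoʳ-< _ (s≤s z≤n)))

    swap-move : ∀ a b → lookup x a ≡ α → lookup x b ≡ not α → t b < t a → t a ≤ t b + B →
      O + B < A → Rebalance p α x
    swap-move a b xa≡α xb≡¬α tb<ta ta≤tb+B gap = z , distance≤2 , α-lighter , ¬α-lighter
      where
      y = flip x a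
      z = flip y b
      b≢a : b ≢ a
      b≢a refl = <-irrefl refl tb<ta
      yb≡¬α : lookup y b ≡ not α
      yb≡¬α = trans (flip-other x a b b≢a) xb≡¬α
      distance≤2 : hamming x z ≤ 2
      distance≤2 = ≤-trans (hamming-triangle x y z) (≤-reflexive (cong₂ _+_ (hamming-flip x a) (hamming-flip y b)))
      not-not : ∀ α → not (not α) ≡ α
      not-not false = refl
      not-not true = refl
      -- α loses a and gains the smaller b
      α-lighter : load α p z < A
      α-lighter = begin-strict
        load α p z                         ≡⟨ subst (λ β → load β p z ≡ load β p y + size (lookup p b)) (not-not α)
                                                (flip-arrives (not α) p y b yb≡¬α) ⟩
        load α p y + size (lookup p b)      <⟨ +-monoʳ-< (load α p y) (s≤s tb<ta) ⟩
        load α p y + size (lookup p a)      ≡⟨ sym (flip-leaves α p x a xa≡α) ⟩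
        A                                  ∎
        where open ≤-Reasoning
      -- ¬α trades b for a, gaining at most B
      ¬α-lighter : load (not α) p z < A
      ¬α-lighter = ≤-<-trans (+-cancelʳ-≤ (size (lookup p b)) _ _ (begin
        load (not α) p z + size (lookup p b) ≡⟨ sym (flip-leaves (not α) p y b yb≡¬α) ⟩
        load (not α) p y                    ≡⟨ flip-arrives α p x a xa≡α ⟩
        O + size (lookup p a)               ≤⟨ +-monoʳ-≤ O (s≤s ta≤tb+B) ⟩
        O + (size (lookup p b) + B)         ≡⟨ cong (O +_) (+-comm (size (lookup p b)) B) ⟩
        O + (B + size (lookup p b))         ≡⟨ sym (+-assoc O B _) ⟩
        O + B + size (lookup p b)           ∎)) gap
        where open ≤-Reasoning

    -- Descend through jobs on α of decreasing size: a job a on α that cannot simply be moved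
    -- has size > B, so the window just below its size contains a job b; if b is on ¬α swap
    -- a and b, otherwise continue with b.
    rebalance : Dense B p → O + B < A → Rebalance p α x
    rebalance dense gap with job-on α p x (≤-<-trans z≤n gap)
    ... | a₀ , xa₀≡α = descend (suc (t a₀)) a₀ ≤-refl xa₀≡α
      where
      large⇒B≤t : ∀ a → ¬ (size (lookup p a) + O < A) → B ≤ t a
      large⇒B≤t a large = ≤-pred (+-cancelˡ-< O B (size (lookup p a))
        (<-≤-trans gap (≤-trans (≮⇒≥ large) (≤-reflexive (+-comm (size (lookup p a)) O)))))

      window-below : ∀ a → B ≤ t a → ∃[ b ] (t b < t a × t a ≤ t b + B)
      window-below a B≤ta with dense (t a ∸ B) (≤-trans (≤-reflexive (m∸n+n≡m B≤ta)) (<⇒≤ (FP.toℕ<n (lookup p a))))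
      ... | b , ta-B≤tb , tb<ta-B+B =
        b , ≤-trans tb<ta-B+B (≤-reflexive (m∸n+n≡m B≤ta))
          , ≤-trans (≤-reflexive (sym (m∸n+n≡m B≤ta))) (+-monoˡ-≤ B ta-B≤tb)

      other-machine : ∀ {c α} → ¬ (c ≡ α) → c ≡ not α
      other-machine {false} {false} c≢α = ⊥-elim (c≢α refl)
      other-machine {false} {true} _ = refl
      other-machine {true} {false} _ = refl
      other-machine {true} {true} c≢α = ⊥-elim (c≢α refl)

      descend : (bound : ℕ) → ∀ a → t a < bound → lookup x a ≡ α → Rebalance p α x
      descend zero a () xa≡α
      descend (suc bound) a ta<bound xa≡α with size (lookup p a) + O <? A
      ... | yes small = single-move a xa≡α small
      ... | no large with window-below a (large⇒B≤t a large)
      ...   | b , tb<ta , ta≤tb+B with lookup x b B.≟ α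
      ...     | yes xb≡α = descend bound b (<-≤-trans tb<ta (≤-pred ta<bound)) xb≡α
      ...     | no xb≢α = swap-move a b xa≡α (other-machine xb≢α) tb<ta ta≤tb+B gap

  discrepancy-gap : ∀ {B a b} → B < ∣ a - b ∣ → b + B < a ⊎ a + B < b
  discrepancy-gap {B} {a} {b} B<∣a-b∣ with ≤-total b a
  ... | inj₁ b≤a = inj₁ (subst (b + B <_) (m+[n∸m]≡n b≤a)
                          (+-monoʳ-< b (subst (B <_) (m≤n⇒∣n-m∣≡n∸m b≤a) B<∣a-b∣)))
  ... | inj₂ a≤b = inj₂ (subst (a + B <_) (m+[n∸m]≡n a≤b)
                          (+-monoʳ-< a (subst (B <_) (m≤n⇒∣m-n∣≡n∸m a≤b) B<∣a-b∣)))

  ⊔-< : ∀ {a b c} → a < c → b < c → a ⊔ b < c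
  ⊔-< {a} {b} a<c b<c with ≤-total a b
  ... | inj₁ a≤b rewrite m≤n⇒m⊔n≡n a≤b = b<c
  ... | inj₂ b≤a rewrite m≥n⇒m⊔n≡m b≤a = a<c

  better-neighbour : ∀ {n} (B : ℕ) (p : Instance n) (x : Bits n) → Dense B p → B < discrepancy p x →
    ∃[ z ] (hamming x z ≤ 2 × makespan p z < makespan p x)
  better-neighbour B p x dense B<disc with discrepancy-gap (subst (B <_) (discrepancy≡ p x) B<disc)
  ... | inj₁ M₁-fuller with rebalance B p false x dense M₁-fuller
  ...   | z , near , l₁ , l₂ = z , near , subst₂ _<_ (sym (makespan≡ p z)) (sym (makespan≡ p x))
                                            (<-≤-trans (⊔-< l₁ l₂) (m≤m⊔n _ _))
  better-neighbour B p x dense B<disc | inj₂ M₂-fuller with rebalance B p true x dense M₂-fuller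
  ...   | z , near , l₂ , l₁ = z , near , subst₂ _<_ (sym (makespan≡ p z)) (sym (makespan≡ p x))
                                            (<-≤-trans (⊔-< l₁ l₂) (m≤n⊔m _ _))

  load≤ : ∀ {m k} α (p : Vec (Fin m) k) (x : Bits k) → load α p x ≤ k * m
  load≤ α [] [] = z≤n
  load≤ {m} α (s ∷ p) (b ∷ x) = +-mono-≤ (job≤ (b xor α)) (load≤ α p x)
    where
    job≤ : ∀ c → (if c then 0 else size s) ≤ m
    job≤ true = z≤n
    job≤ false = FP.toℕ<n s

  makespan≤n² : ∀ {n} (p : Instance n) (x : Bits n) → makespan p x ≤ n * n
  makespan≤n² p x = subst (_≤ _) (sym (makespan≡ p x)) (⊔-lub (load≤ false p x) (load≤ true p x))


module Drift where

  -- The sub-probability vector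
  -- notHit t of Defs evolves by one step of the kernel followed by killing the runs that hit
  -- discrepancy ≤ B.  If a potential g ≥ 0 satisfies E[g(x') ; x' not hit | x] ≤ ρ g(x) for
  -- every x not hit, then E[g(x_t) ; not hit by t] ≤ ρ^t g(x₀).  With g = 2^makespan on a
  -- B-dense instance the structural lemma gives ρ = 1 - q/2, q = n⁻²(1 - 1/n)ⁿ being a lower
  -- bound on the probability of the mutation to the better neighbour.

  open import Data.Nat using (ℕ; zero; suc; _∸_; NonZero; _≤ᵇ_)
  import Data.Nat as N
  import Data.Nat.Properties as NP
  open import Data.List using (List)
  open import Data.Bool using (Bool; true; false; _∧_; if_then_else_; not; T)
  open import Data.Product using (_,_)
  open import Data.Empty using (⊥-elim)
  open import Data.Unit using (tt)
  open import Data.Integer using (+_)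
  open import Data.Rational hiding (truncate; NonZero; _≤ᵇ_)
  open import Data.Rational.Properties
  open import Data.Rational.Solver using (module +-*-Solver)
  open import Relation.Binary.PropositionalEquality hiding ([_])
  open import Defs
  open RationalArith
  open FiniteSums
  open BitVectors
  open Improvement using (Dense; better-neighbour; makespan≤n²)
  open ≤-Reasoning

  -- q n = n⁻² (1 - 1/n)ⁿ bounds from below the probability that mutation produces a given
  -- point at Hamming distance ≤ 2, and ρ n = 1 - q n / 2 is the resulting contraction factor
  q : (n : ℕ) .{{_ : NonZero n}} → ℚ
  q n = (+ 1 / n) ^ℚ 2 * (1ℚ - + 1 / n) ^ℚ n

  ρ : (n : ℕ) .{{_ : NonZero n}} → ℚ
  ρ n = 1ℚ - q n * ½

  q≤1 : ∀ n .{{_ : NonZero n}} → q n ≤ 1ℚ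
  q≤1 n = mul-mono (0≤ι 1) (pow-nonNeg n (0≤1-1/n n)) (pow≤1 2 (0≤1/n n) (1/n≤1 n)) (pow≤1 n (0≤1-1/n n) (1-1/n≤1 n))

  0≤ρ : ∀ n .{{_ : NonZero n}} → 0ℚ ≤ ρ n
  0≤ρ n = sub-nonNeg (≤-trans (mul-monoʳ 0≤½ (q≤1 n)) (≤-trans (≤-reflexive (*-identityˡ ½)) ½≤1))

  mutProb-nonNeg : ∀ n .{{_ : NonZero n}} (x z : Bits n) → 0ℚ ≤ mutProb n x z
  mutProb-nonNeg n x z = mul-nonNeg (pow-nonNeg (hamming x z) (0≤1/n n)) (pow-nonNeg (n ∸ hamming x z) (0≤1-1/n n))

  mutProb≥q : ∀ n .{{_ : NonZero n}} (x z : Bits n) → hamming x z N.≤ 2 → q n ≤ mutProb n x z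
  mutProb≥q n x z near = mul-mono (pow-nonNeg (hamming x z) (0≤1/n n)) (pow-nonNeg n (0≤1-1/n n))
    (pow-antitone (hamming x z) 2 (0≤1/n n) (1/n≤1 n) near)
    (pow-antitone (n ∸ hamming x z) n (0≤1-1/n n) (1-1/n≤1 n) (NP.m∸n≤m n (hamming x z)))

  mutProb-sums-to-1 : ∀ n .{{_ : NonZero n}} (x : Bits n) → S (mutProb n x) (allBits n) ≡ 1ℚ
  mutProb-sums-to-1 n x = mutation-weights-sum-to-1 n (+ 1 / n) (1ℚ - + 1 / n) x (u+[1-u]≡1 (+ 1 / n))
    where
    open +-*-Solver
    u+[1-u]≡1 : ∀ u → u + (1ℚ - u) ≡ 1ℚ
    u+[1-u]≡1 = solve 1 (λ u → u :+ (con 1ℚ :- u) := con 1ℚ) refl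

  module Run (n : ℕ) {{_ : NonZero n}} (p : Instance n) (B : ℕ) (x₀ : Bits n) where

    A : List (Bits n)
    A = allBits n

    M : Bits n → ℕ
    M = makespan p

    bad : Bits n → Bool
    bad y = not (discrepancy p y ≤ᵇ B)

    kept : Bits n → Bits n → Bits n
    kept x z = if M z ≤ᵇ M x then z else x

    select : Bits n → Bits n → Bits n → ℚ
    select x z y = if M z ≤ᵇ M x then [ z == y ] else [ x == y ]

    kept-makespan : ∀ x z → M (kept x z) N.≤ M x
    kept-makespan x z with M z ≤ᵇ M x in z≤x
    ... | true = NP.≤ᵇ⇒≤ (M z) (M x) (subst T (sym z≤x) tt)
    ... | false = NP.≤-refl

    kept-better : ∀ x z → M z N.≤ M x → kept x z ≡ z
    kept-better x z le with M z ≤ᵇ M x in z≤x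
    ... | true = refl
    ... | false = ⊥-elim (subst T z≤x (NP.≤⇒≤ᵇ le))

    select-nonNeg : ∀ x z y → 0ℚ ≤ select x z y
    select-nonNeg x z y with M z ≤ᵇ M x
    ... | true = []-nonNeg _
    ... | false = []-nonNeg _

    kernel-nonNeg : ∀ x y → 0ℚ ≤ eaKernel n p x y
    kernel-nonNeg x y = S-nonNeg A (λ z → mul-nonNeg (mutProb-nonNeg n x z) (select-nonNeg x z y))

    notHit-nonNeg : ∀ t y → 0ℚ ≤ notHit n p B x₀ t y
    notHit-nonNeg zero y = []-nonNeg _
    notHit-nonNeg (suc t) y =
      mul-nonNeg ([]-nonNeg (bad y)) (S-nonNeg A (λ x → mul-nonNeg (notHit-nonNeg t x) (kernel-nonNeg x y)))

    notHit-good : ∀ t y → bad y ≡ false → notHit n p B x₀ t y ≡ 0ℚ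
    notHit-good zero y good rewrite good with y == x₀
    ... | true = refl
    ... | false = refl
    notHit-good (suc t) y good rewrite good = *-zeroˡ (S (λ x → notHit n p B x₀ t x * eaKernel n p x y) A)

    Ψ : (Bits n → ℚ) → Bits n → ℚ
    Ψ g x = S (λ y → ([ bad y ] * g y) * eaKernel n p x y) A

    Φ : (Bits n → ℚ) → ℕ → ℚ
    Φ g t = S (λ y → notHit n p B x₀ t y * g y) A

    Ψ-by-mutation : ∀ g x → Ψ g x ≡ S (λ z → mutProb n x z * ([ bad (kept x z) ] * g (kept x z))) A
    Ψ-by-mutation g x = begin-equality
      S (λ y → h y * S (λ z → mutProb n x z * select x z y) A) A
        ≡⟨ S-cong A (λ y → sym (S-*ˡ (h y) (λ z → mutProb n x z * select x z y) A)) ⟩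
      S (λ y → S (λ z → h y * (mutProb n x z * select x z y)) A) A
        ≡⟨ S-swap (λ y z → h y * (mutProb n x z * select x z y)) A A ⟩
      S (λ z → S (λ y → h y * (mutProb n x z * select x z y)) A) A
        ≡⟨ S-cong A (λ z → trans (S-cong A (λ y → swap-front (h y) (mutProb n x z) (select x z y)))
                                 (S-*ˡ (mutProb n x z) (λ y → h y * select x z y) A)) ⟩
      S (λ z → mutProb n x z * S (λ y → h y * select x z y) A) A
        ≡⟨ S-cong A (λ z → cong (mutProb n x z *_) (S-select z)) ⟩
      S (λ z → mutProb n x z * h (kept x z)) A ∎
      where
      h : Bits n → ℚ
      h y = [ bad y ] * g y
      S-select : ∀ z → S (λ y → h y * select x z y) A ≡ h (kept x z)
      S-select z with M z ≤ᵇ M x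
      ... | true = S-indicator n z h
      ... | false = S-indicator n x h
      open +-*-Solver
      swap-front : ∀ a b c → a * (b * c) ≡ b * (a * c)
      swap-front = solve 3 (λ a b c → a :* (b :* c) := b :* (a :* c)) refl

    Φ-suc : ∀ g t → Φ g (suc t) ≡ S (λ x → notHit n p B x₀ t x * Ψ g x) A
    Φ-suc g t = begin-equality
      S (λ y → ([ bad y ] * S (λ x → N t x * eaKernel n p x y) A) * g y) A
        ≡⟨ S-cong A (λ y → trans (rearrange [ bad y ] (S (λ x → N t x * eaKernel n p x y) A) (g y))
              (trans (sym (S-*ˡ ([ bad y ] * g y) (λ x → N t x * eaKernel n p x y) A))
                     (S-cong A (λ x → swap-front ([ bad y ] * g y) (N t x) (eaKernel n p x y))))) ⟩
      S (λ y → S (λ x → N t x * (([ bad y ] * g y) * eaKernel n p x y)) A) A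
        ≡⟨ S-swap (λ y x → N t x * (([ bad y ] * g y) * eaKernel n p x y)) A A ⟩
      S (λ x → S (λ y → N t x * (([ bad y ] * g y) * eaKernel n p x y)) A) A
        ≡⟨ S-cong A (λ x → S-*ˡ (N t x) (λ y → ([ bad y ] * g y) * eaKernel n p x y) A) ⟩
      S (λ x → N t x * Ψ g x) A ∎
      where
      N = notHit n p B x₀
      open +-*-Solver
      rearrange : ∀ b s g → (b * s) * g ≡ (b * g) * s
      rearrange = solve 3 (λ b s g → (b :* s) :* g := (b :* g) :* s) refl
      swap-front : ∀ a b c → a * (b * c) ≡ b * (a * c)
      swap-front = solve 3 (λ a b c → a :* (b :* c) := b :* (a :* c)) refl

    Φ-contracts : ∀ g r t → (∀ x → bad x ≡ true → Ψ g x ≤ r * g x) → Φ g (suc t) ≤ r * Φ g t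
    Φ-contracts g r t drift = begin
      Φ g (suc t)                       ≡⟨ Φ-suc g t ⟩
      S (λ x → N t x * Ψ g x) A         ≤⟨ S-mono A pointwise ⟩
      S (λ x → r * (N t x * g x)) A     ≡⟨ S-*ˡ r _ A ⟩
      r * Φ g t                         ∎
      where
      N = notHit n p B x₀
      open +-*-Solver
      swap-front : ∀ a b c → a * (b * c) ≡ b * (a * c)
      swap-front = solve 3 (λ a b c → a :* (b :* c) := b :* (a :* c)) refl
      pointwise : ∀ x → N t x * Ψ g x ≤ r * (N t x * g x)
      pointwise x with bad x in bad-x
      ... | true = ≤-trans (mul-monoˡ (notHit-nonNeg t x) (drift x bad-x)) (≤-reflexive (swap-front (N t x) r (g x)))
      ... | false rewrite notHit-good t x bad-x =
        ≤-reflexive (trans (*-zeroˡ (Ψ g x)) (sym (trans (cong (r *_) (*-zeroˡ (g x))) (*-zeroʳ r))))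

    Φ-initial : ∀ g → (∀ y → 0ℚ ≤ g y) → Φ g 0 ≤ g x₀
    Φ-initial g 0≤g = begin
      S (λ y → [ (y == x₀) ∧ bad y ] * g y) A ≤⟨ S-mono A pointwise ⟩
      S (λ y → g y * [ x₀ == y ]) A           ≡⟨ S-indicator n x₀ g ⟩
      g x₀                                    ∎
      where
      pointwise : ∀ y → [ (y == x₀) ∧ bad y ] * g y ≤ g y * [ x₀ == y ]
      pointwise y = ≤-trans (mul-monoʳ (0≤g y) ([]-∧ (y == x₀) (bad y)))
        (≤-reflexive (trans (*-comm [ y == x₀ ] (g y)) (cong (λ b → g y * [ b ]) (==-sym y x₀))))

    multiplicative-drift : ∀ g r → 0ℚ ≤ r → (∀ y → 0ℚ ≤ g y) → (∀ x → bad x ≡ true → Ψ g x ≤ r * g x) →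
      ∀ t → Φ g t ≤ r ^ℚ t * g x₀
    multiplicative-drift g r 0≤r 0≤g drift zero = ≤-trans (Φ-initial g 0≤g) (≤-reflexive (sym (*-identityˡ _)))
    multiplicative-drift g r 0≤r 0≤g drift (suc t) = begin
      Φ g (suc t)           ≤⟨ Φ-contracts g r t drift ⟩
      r * Φ g t             ≤⟨ mul-monoˡ 0≤r (multiplicative-drift g r 0≤r 0≤g drift t) ⟩
      r * (r ^ℚ t * g x₀)   ≡⟨ sym (*-assoc r _ _) ⟩
      r * r ^ℚ t * g x₀     ∎

    failProb≤Φ : ∀ g t → (∀ y → 1ℚ ≤ g y) → failProb n p B x₀ t ≤ Φ g t
    failProb≤Φ g t 1≤g = S-mono A (λ y → ≤-trans (≤-reflexive (sym (*-identityʳ _))) (mul-monoˡ (notHit-nonNeg t y) (1≤g y)))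

    failProb≤1 : ∀ t → failProb n p B x₀ t ≤ 1ℚ
    failProb≤1 t = begin
      failProb n p B x₀ t  ≤⟨ failProb≤Φ (λ _ → 1ℚ) t (λ _ → ≤-refl) ⟩
      Φ (λ _ → 1ℚ) t       ≤⟨ multiplicative-drift (λ _ → 1ℚ) 1ℚ (0≤ι 1) (λ _ → 0≤ι 1) no-growth t ⟩
      1ℚ ^ℚ t * 1ℚ         ≡⟨ trans (*-identityʳ _) (1-pow t) ⟩
      1ℚ                   ∎
      where
      no-growth : ∀ x → bad x ≡ true → Ψ (λ _ → 1ℚ) x ≤ 1ℚ * 1ℚ
      no-growth x _ = begin
        Ψ (λ _ → 1ℚ) x
          ≡⟨ Ψ-by-mutation (λ _ → 1ℚ) x ⟩
        S (λ z → mutProb n x z * ([ bad (kept x z) ] * 1ℚ)) A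
          ≤⟨ S-mono A (λ z → mul-monoˡ (mutProb-nonNeg n x z)
               (≤-trans (≤-reflexive (*-identityʳ [ bad (kept x z) ])) ([]-≤1 (bad (kept x z))))) ⟩
        S (λ z → mutProb n x z * 1ℚ) A
          ≡⟨ trans (S-cong A (λ z → *-identityʳ _)) (mutProb-sums-to-1 n x) ⟩
        1ℚ ∎

    potential : Bits n → ℚ
    potential y = ι 2 ^ℚ M y

    1≤2 : 1ℚ ≤ ι 2
    1≤2 = ι-mono {1} {2} (N.s≤s N.z≤n)

    potential-nonNeg : ∀ y → 0ℚ ≤ potential y
    potential-nonNeg y = pow-nonNeg (M y) (≤-trans (0≤ι 1) 1≤2)

    potential-mono : ∀ y x → M y N.≤ M x → potential y ≤ potential x
    potential-mono y x le = pow-monotone (M y) (M x) 1≤2 le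

    potential-halves : ∀ y x → M y N.< M x → potential y ≤ potential x * ½
    potential-halves y x lt = begin
      potential y                    ≡⟨ sym (*-identityʳ _) ⟩
      potential y * (ι 2 * ½)        ≡⟨ sym (*-assoc (potential y) (ι 2) ½) ⟩
      potential y * ι 2 * ½          ≤⟨ mul-monoʳ 0≤½ (≤-trans (≤-reflexive (*-comm (potential y) (ι 2)))
                                          (pow-monotone (suc (M y)) (M x) 1≤2 lt)) ⟩
      potential x * ½                ∎

    bad⇒B<discrepancy : ∀ x → bad x ≡ true → B N.< discrepancy p x
    bad⇒B<discrepancy x bad-x = NP.≰⇒> (λ le → subst T (not-true (discrepancy p x N.≤ᵇ B) bad-x) (NP.≤⇒≤ᵇ le))
      where
      not-true : ∀ b → not b ≡ true → b ≡ false
      not-true false _ = refl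

    -- the drift condition: on a dense instance the better neighbour z₀ is produced with
    -- probability ≥ q and halves the potential, all other mutations do not increase it
    potential-drift : Dense B p → ∀ x → bad x ≡ true → Ψ potential x ≤ ρ n * potential x
    potential-drift dense x bad-x with better-neighbour B p x dense (bad⇒B<discrepancy x bad-x)
    ... | z₀ , near , better = begin
      Ψ potential x        ≡⟨ Ψ-by-mutation potential x ⟩
      S f A                ≤⟨ x+d≤y⇒x≤y-d (≤-trans (S-one-smaller f (λ z → mutProb n x z * G) z₀ δ bounded at-z₀)
                                                     (≤-reflexive total)) ⟩
      G - δ                ≤⟨ +-monoʳ-≤ G (neg-antimono-≤ (mul-monoʳ 0≤½ (mul-monoʳ (potential-nonNeg x) (mutProb≥q n x z₀ near)))) ⟩
      G - q n * G * ½      ≡⟨ factor G (q n) ⟩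
      ρ n * G              ∎
      where
      G = potential x
      δ = mutProb n x z₀ * G * ½
      f : Bits n → ℚ
      f z = mutProb n x z * ([ bad (kept x z) ] * potential (kept x z))
      open +-*-Solver
      factor : ∀ G q → G - q * G * ½ ≡ (1ℚ - q * ½) * G
      factor = solve 2 (λ G q → G :- q :* G :* con ½ := (con 1ℚ :- q :* con ½) :* G) refl
      halves : ∀ m G → m * (G * ½) + m * G * ½ ≡ m * G
      halves = solve 2 (λ m G → m :* (G :* con ½) :+ m :* G :* con ½ := m :* G) refl
      kept-term≤ : ∀ z → [ bad (kept x z) ] * potential (kept x z) ≤ potential (kept x z)
      kept-term≤ z = ≤-trans (mul-monoʳ (potential-nonNeg (kept x z)) ([]-≤1 (bad (kept x z))))
                             (≤-reflexive (*-identityˡ _))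
      bounded : ∀ z → f z ≤ mutProb n x z * G
      bounded z = mul-monoˡ (mutProb-nonNeg n x z)
        (≤-trans (kept-term≤ z) (potential-mono (kept x z) x (kept-makespan x z)))
      at-z₀ : f z₀ + δ ≤ mutProb n x z₀ * G
      at-z₀ = begin
        f z₀ + δ
          ≤⟨ +-monoˡ-≤ δ (mul-monoˡ (mutProb-nonNeg n x z₀) (≤-trans (kept-term≤ z₀)
               (subst (λ k → potential k ≤ G * ½) (sym (kept-better x z₀ (NP.<⇒≤ better)))
                 (potential-halves z₀ x better)))) ⟩
        mutProb n x z₀ * (G * ½) + δ ≡⟨ halves (mutProb n x z₀) G ⟩
        mutProb n x z₀ * G ∎
      total : S (λ z → mutProb n x z * G) A ≡ G
      total = trans (S-*ʳ G (mutProb n x) A) (trans (cong (_* G) (mutProb-sums-to-1 n x)) (*-identityˡ G))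

    failProb-dense : Dense B p → ∀ t → failProb n p B x₀ t ≤ ρ n ^ℚ t * ι 2 ^ℚ (n N.* n)
    failProb-dense dense t = begin
      failProb n p B x₀ t     ≤⟨ failProb≤Φ potential t (λ y → pow≥1 (M y) 1≤2) ⟩
      Φ potential t           ≤⟨ multiplicative-drift potential (ρ n) (0≤ρ n) potential-nonNeg (potential-drift dense) t ⟩
      ρ n ^ℚ t * potential x₀ ≤⟨ mul-monoˡ (pow-nonNeg t (0≤ρ n)) (pow-monotone (M x₀) (n N.* n) 1≤2 (makespan≤n² p x₀)) ⟩
      ρ n ^ℚ t * ι 2 ^ℚ (n N.* n) ∎


module Windows where

  -- Window s is the range [s, s+B) of size indices; it is empty
  -- in p if it fits below n and no job size falls into it.  An instance without empty windows
  -- is B-dense.  If each p_j independently takes each of the B values of a window with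
  -- probability ≥ l, the window is empty with probability ≤ (1 - lB)ⁿ, the jobs missing it
  -- independently.

  open import Data.Nat using (ℕ; zero; suc; _∸_; NonZero; _≤ᵇ_; _<ᵇ_)
  import Data.Nat as N
  import Data.Nat.Properties as NP
  open import Data.Fin using (Fin; toℕ)
  import Data.Fin as F
  open import Data.Vec using (Vec; []; _∷_; lookup)
  open import Data.List using (tabulate; allFin)
  open import Data.Bool using (Bool; true; false; _∧_; _∨_; not; T)
  open import Data.Product using (∃-syntax; _,_)
  open import Data.Unit using (tt)
  open import Data.Rational hiding (truncate; NonZero; _≤ᵇ_)
  open import Data.Rational.Properties
  open import Data.Rational.Solver using (module +-*-Solver)
  open import Relation.Binary.PropositionalEquality hiding ([_])
  open import Function using (_∘_)
  open import Defs
  open RationalArith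
  open FiniteSums
  open Improvement using (Dense)
  open ≤-Reasoning

  true⇒T : ∀ {b} → b ≡ true → T b
  true⇒T refl = tt

  T⇒true : ∀ {b} → T b → b ≡ true
  T⇒true {true} _ = refl

  rangeSum : (ℕ → Bool) → ℕ → ℕ → ℚ
  rangeSum P k zero = 0ℚ
  rangeSum P k (suc len) = [ P k ] + rangeSum P (suc k) len

  rangeSum-tabulate : ∀ {m} (P : ℕ → Bool) len k (g : Fin len → Fin m) → (∀ i → toℕ (g i) ≡ k N.+ toℕ i) →
    S (λ i → [ P (toℕ i) ]) (tabulate g) ≡ rangeSum P k len
  rangeSum-tabulate P zero k g g≡ = refl
  rangeSum-tabulate P (suc len) k g g≡ = cong₂ _+_ (cong (λ t → [ P t ]) (trans (g≡ F.zero) (NP.+-identityʳ k)))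
    (rangeSum-tabulate P len (suc k) (g ∘ F.suc) (λ i → trans (g≡ (F.suc i)) (NP.+-suc k (toℕ i))))

  rangeSum-split : ∀ P k a b → rangeSum P k (a N.+ b) ≡ rangeSum P k a + rangeSum P (k N.+ a) b
  rangeSum-split P k zero b = trans (cong (λ t → rangeSum P t b) (sym (NP.+-identityʳ k))) (sym (+-identityˡ _))
  rangeSum-split P k (suc a) b = trans (cong ([ P k ] +_) (trans (rangeSum-split P (suc k) a b)
      (cong (λ t → rangeSum P (suc k) a + rangeSum P t b) (sym (NP.+-suc k a)))))
    (sym (+-assoc [ P k ] _ _))

  rangeSum-nonNeg : ∀ P k len → 0ℚ ≤ rangeSum P k len
  rangeSum-nonNeg P k zero = ≤-refl
  rangeSum-nonNeg P k (suc len) = add-nonNeg ([]-nonNeg (P k)) (rangeSum-nonNeg P (suc k) len)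

  rangeSum-all : ∀ P k len → (∀ i → i N.< len → P (k N.+ i) ≡ true) → rangeSum P k len ≡ ι len
  rangeSum-all P k zero all = refl
  rangeSum-all P k (suc len) all =
    trans (cong₂ _+_ (cong [_] (trans (cong P (sym (NP.+-identityʳ k))) (all 0 (N.s≤s N.z≤n))))
                     (rangeSum-all P (suc k) len (λ i i<len → trans (cong P (sym (NP.+-suc k i))) (all (suc i) (N.s≤s i<len)))))
      (sym (ι-suc len))

  module _ (n B : ℕ) where

    inWindow : ℕ → ℕ → Bool
    inWindow s t = (s ≤ᵇ t) ∧ (t <ᵇ s N.+ B)

    hits : ∀ {k} → ℕ → Vec (Fin n) k → Bool
    hits s [] = false
    hits s (i ∷ p) = inWindow s (toℕ i) ∨ hits s p

    emptyWindow : ℕ → Vec (Fin n) n → Bool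
    emptyWindow s p = (s N.+ B ≤ᵇ n) ∧ not (hits s p)

    window-size : ∀ s → s N.+ B N.≤ n → ι B ≤ S (λ i → [ inWindow s (toℕ i) ]) (allFin n)
    window-size s fits = begin
      ι B                                    ≡⟨ sym (rangeSum-all P s B inside) ⟩
      rangeSum P s B                         ≤⟨ ≤-+-nonNeg (rangeSum-nonNeg P (s N.+ B) rest) ⟩
      rangeSum P s B + rangeSum P (s N.+ B) rest ≡⟨ sym (rangeSum-split P s B rest) ⟩
      rangeSum P s (B N.+ rest)              ≤⟨ ≤-trans (≤-reflexive (sym (+-identityˡ _))) (+-monoˡ-≤ _ (rangeSum-nonNeg P 0 s)) ⟩
      rangeSum P 0 s + rangeSum P s (B N.+ rest) ≡⟨ sym (rangeSum-split P 0 s (B N.+ rest)) ⟩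
      rangeSum P 0 (s N.+ (B N.+ rest))      ≡⟨ cong (rangeSum P 0) s+B+rest≡n ⟩
      rangeSum P 0 n                         ≡⟨ sym (rangeSum-tabulate P n 0 (λ i → i) (λ i → refl)) ⟩
      S (λ i → [ inWindow s (toℕ i) ]) (allFin n) ∎
      where
      P = inWindow s
      rest = n ∸ (s N.+ B)
      s+B+rest≡n : s N.+ (B N.+ rest) ≡ n
      s+B+rest≡n = trans (sym (NP.+-assoc s B rest)) (NP.m+[n∸m]≡n fits)
      inside : ∀ i → i N.< B → P (s N.+ i) ≡ true
      inside i i<B = cong₂ _∧_ (T⇒true (NP.≤⇒≤ᵇ (NP.m≤m+n s i))) (T⇒true (NP.<⇒<ᵇ (NP.+-monoʳ-< s i<B)))

    hits-witness : ∀ {k} s (p : Vec (Fin n) k) → hits s p ≡ true → ∃[ j ] inWindow s (toℕ (lookup p j)) ≡ true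
    hits-witness s (i ∷ p) hit with inWindow s (toℕ i) in here
    ... | true = F.zero , here
    ... | false with hits-witness s p hit
    ...   | j , there = F.suc j , there

    no-empty-window⇒dense : (p : Vec (Fin n) n) → (∀ s → s N.< suc n → emptyWindow s p ≡ false) → Dense B p
    no-empty-window⇒dense p none s fits with hits s p in hit
    ... | true with hits-witness s p hit
    ...   | j , in-j = j , NP.≤ᵇ⇒≤ s _ (true⇒T (∧-left in-j)) , NP.<ᵇ⇒< _ (s N.+ B) (true⇒T (∧-right in-j))
      where
      ∧-left : ∀ {a b} → a ∧ b ≡ true → a ≡ true
      ∧-left {true} _ = refl
      ∧-right : ∀ {a b} → a ∧ b ≡ true → b ≡ true
      ∧-right {true} e = e
    no-empty-window⇒dense p none s fits | false with
      trans (sym (none s (N.s≤s (NP.≤-trans (NP.m≤m+n s B) fits)))) (cong₂ (λ a b → a ∧ not b) (T⇒true (NP.≤⇒≤ᵇ fits)) hit)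
    ... | ()

    misses-product : ∀ {k} s (p : Vec (Fin n) k) → [ not (hits s p) ] ≡ prodV (λ _ i → [ not (inWindow s (toℕ i)) ]) p
    misses-product s [] = refl
    misses-product s (i ∷ p) with inWindow s (toℕ i)
    ... | true = sym (*-zeroˡ (prodV (λ _ i → [ not (inWindow s (toℕ i)) ]) p))
    ... | false = trans (misses-product s p) (sym (*-identityˡ (prodV (λ _ i → [ not (inWindow s (toℕ i)) ]) p)))

    module _ .{{_ : NonZero n}} (μ : Fin n → Fin n → ℚ) (l : ℚ) (0≤l : 0ℚ ≤ l)
             (μ-sum : ∀ j → S (μ j) (allFin n) ≡ 1ℚ) (μ≥l : ∀ j i → l ≤ μ j i) where

      μ-nonNeg : ∀ j i → 0ℚ ≤ μ j i
      μ-nonNeg j i = ≤-trans 0≤l (μ≥l j i)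

      job-misses : ∀ s → s N.+ B N.≤ n → ∀ j → S (λ i → μ j i * [ not (inWindow s (toℕ i)) ]) (allFin n) ≤ 1ℚ - l * ι B
      job-misses s fits j = begin
        miss                    ≡⟨ sym (trans (cong (_- S hit (allFin n)) (sym miss+hit≡1)) (cancel miss _)) ⟩
        1ℚ - S hit (allFin n)   ≤⟨ +-monoʳ-≤ 1ℚ (neg-antimono-≤ lB≤hit) ⟩
        1ℚ - l * ι B            ∎
        where
        hit : Fin n → ℚ
        hit i = μ j i * [ inWindow s (toℕ i) ]
        miss = S (λ i → μ j i * [ not (inWindow s (toℕ i)) ]) (allFin n)
        miss+hit≡1 : miss + S hit (allFin n) ≡ 1ℚ
        miss+hit≡1 = trans (sym (S-+ _ hit (allFin n))) (trans (S-cong (allFin n) (λ i →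
          trans (sym (*-distribˡ-+ (μ j i) _ _)) (trans (cong (μ j i *_)
            (trans (+-comm [ not (inWindow s (toℕ i)) ] [ inWindow s (toℕ i) ]) ([]-not (inWindow s (toℕ i)))))
            (*-identityʳ _)))) (μ-sum j))
        open +-*-Solver
        cancel : ∀ a b → a + b - b ≡ a
        cancel = solve 2 (λ a b → a :+ b :- b := a) refl
        lB≤hit : l * ι B ≤ S hit (allFin n)
        lB≤hit = begin
          l * ι B                                         ≤⟨ mul-monoˡ 0≤l (window-size s fits) ⟩
          l * S (λ i → [ inWindow s (toℕ i) ]) (allFin n) ≡⟨ sym (S-*ˡ l _ (allFin n)) ⟩
          S (λ i → l * [ inWindow s (toℕ i) ]) (allFin n) ≤⟨ S-mono (allFin n) (λ i → mul-monoʳ ([]-nonNeg (inWindow s (toℕ i))) (μ≥l j i)) ⟩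
          S hit (allFin n)                                ∎

      empty-window-probability : ∀ s (E : ℚ) → 0ℚ ≤ E →
        (s N.+ B N.≤ n → 0ℚ ≤ 1ℚ - l * ι B → (1ℚ - l * ι B) ^ℚ n ≤ E) →
        S (λ p → prodV μ p * [ emptyWindow s p ]) (allInstances n) ≤ E
      empty-window-probability s E 0≤E bound with s N.+ B ≤ᵇ n in fits?
      ... | false = ≤-trans (≤-reflexive (trans (S-cong (allInstances n) (λ p → *-zeroʳ (prodV μ p))) (S-0 (allInstances n)))) 0≤E
      ... | true = begin
        S (λ p → prodV μ p * [ not (hits s p) ]) (allInstances n)
          ≡⟨ S-cong (allInstances n) (λ p → trans (cong (prodV μ p *_) (misses-product s p)) (prodV-* μ _ p)) ⟩
        S (prodV (λ j i → μ j i * [ not (inWindow s (toℕ i)) ])) (allInstances n)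
          ≡⟨ S-prodV (allFin n) n _ ⟩
        Π n (λ j → S (λ i → μ j i * [ not (inWindow s (toℕ i)) ]) (allFin n))
          ≤⟨ Π-≤-pow n _ (1ℚ - l * ι B) miss-nonNeg (job-misses s fits) ⟩
        (1ℚ - l * ι B) ^ℚ n
          ≤⟨ bound fits 0≤1-lB ⟩
        E ∎
        where
        fits : s N.+ B N.≤ n
        fits = NP.≤ᵇ⇒≤ _ n (true⇒T fits?)
        miss-nonNeg : ∀ j → 0ℚ ≤ S (λ i → μ j i * [ not (inWindow s (toℕ i)) ]) (allFin n)
        miss-nonNeg j = S-nonNeg (allFin n) (λ i → mul-nonNeg (μ-nonNeg j i) ([]-nonNeg (not (inWindow s (toℕ i)))))
        some-job : Fin n
        some-job = F.fromℕ< (N.>-nonZero⁻¹ n)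
        0≤1-lB : 0ℚ ≤ 1ℚ - l * ι B
        0≤1-lB = ≤-trans (miss-nonNeg some-job) (job-misses s fits some-job)


module Estimates where

  -- The numerical estimates, for n ≥ 2 and L = ⌈log₂ n⌉ (so n ≤ 2^L):
  --  * the dense-instance bound ρ^T 2^(n²) · n^c ≤ 1 for T = 32(1+c) n⁴ L, because
  --    ρ ≤ 1 - 1/(32n²) (from (1-1/n)ⁿ ≥ 1/16) and the halving lemma;
  --  * the empty-window bound (1 - c₁B/n)ⁿ ≤ 2^(-r) for B = 2A r with c₁A ≥ 1 and
  --    r = (c+2)L, and then (n+1) 2^(-r) n^c ≤ 1.

  open import Data.Nat using (ℕ; zero; suc; NonZero; ⌈_/2⌉)
  import Data.Nat as N
  import Data.Nat.Properties as NP
  open import Data.Nat.Logarithm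
  open import Data.Nat.Induction using (<-rec)
  import Data.Nat.DivMod as DM
  import Data.Nat.Solver
  open import Data.Integer using (+_)
  open import Data.Rational hiding (NonZero)
  open import Data.Rational.Properties
  open import Data.Rational.Solver using (module +-*-Solver)
  open import Relation.Binary.PropositionalEquality
  open import Data.Product using (_×_; _,_; proj₁; proj₂)
  open import Defs using (_^ℚ_)
  open RationalArith
  open Drift using (q; ρ)
  open ≤-Reasoning
  module NS = Data.Nat.Solver.+-*-Solver

  2*⌈n/2⌉≥n : ∀ n → n N.≤ 2 N.* ⌈ n /2⌉
  2*⌈n/2⌉≥n n = NP.≤-trans (NP.≤-reflexive (sym (NP.⌊n/2⌋+⌈n/2⌉≡n n)))
    (NP.≤-trans (NP.+-monoˡ-≤ ⌈ n /2⌉ (NP.⌊n/2⌋≤⌈n/2⌉ n)) (NP.≤-reflexive (cong (⌈ n /2⌉ N.+_) (sym (NP.+-identityʳ _)))))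

  2*⌈n/2⌉≤n+1 : ∀ n → 2 N.* ⌈ n /2⌉ N.≤ suc n
  2*⌈n/2⌉≤n+1 zero = N.z≤n
  2*⌈n/2⌉≤n+1 (suc zero) = N.s≤s (N.s≤s N.z≤n)
  2*⌈n/2⌉≤n+1 (suc (suc n)) =
    NP.≤-trans (NP.≤-reflexive (cong suc (NP.+-suc ⌈ n /2⌉ _))) (N.s≤s (N.s≤s (2*⌈n/2⌉≤n+1 n)))

  1≤log₂ : ∀ n → 2 N.≤ n → 1 N.≤ ⌈log₂ n ⌉
  1≤log₂ n 2≤n = ⌈log₂⌉-mono-≤ {2} {n} 2≤n

  -- by strong induction, halving n lowers ⌈log₂ n⌉ by one
  n≤2^⌈log₂n⌉ : ∀ n → n N.≤ 2 N.^ ⌈log₂ n ⌉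
  n≤2^⌈log₂n⌉ = <-rec _ step
    where
    step : ∀ n → (∀ {m} → m N.< n → m N.≤ 2 N.^ ⌈log₂ m ⌉) → n N.≤ 2 N.^ ⌈log₂ n ⌉
    step zero rec = N.z≤n
    step (suc zero) rec = N.s≤s N.z≤n
    step n@(suc (suc k)) rec = NP.≤-trans (2*⌈n/2⌉≥n n) (NP.≤-trans
      (NP.*-monoʳ-≤ 2 (NP.≤-trans (rec (NP.⌈n/2⌉<n k)) (NP.≤-reflexive (cong (2 N.^_) (⌈log₂⌈n/2⌉⌉≡⌈log₂n⌉∸1 n)))))
      (NP.≤-reflexive (cong (2 N.^_) (NP.m+[n∸m]≡n (1≤log₂ n (N.s≤s (N.s≤s N.z≤n)))))))

  n^c≤2^[L*c] : ∀ n c → ι (n N.^ c) ≤ ι 2 ^ℚ (⌈log₂ n ⌉ N.* c)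
  n^c≤2^[L*c] n c = begin
    ι (n N.^ c)                  ≡⟨ ι-pow n c ⟩
    ι n ^ℚ c                     ≤⟨ pow-mono c (0≤ι n) (≤-trans (ι-mono (n≤2^⌈log₂n⌉ n)) (≤-reflexive (ι-pow 2 ⌈log₂ n ⌉))) ⟩
    (ι 2 ^ℚ ⌈log₂ n ⌉) ^ℚ c      ≡⟨ sym (pow-* (ι 2) ⌈log₂ n ⌉ c) ⟩
    ι 2 ^ℚ (⌈log₂ n ⌉ N.* c)     ∎

  blocks : ∀ n r .{{_ : NonZero r}} → r N.≤ n → (n N./ r) N.* r N.≤ n × n N.≤ (n N./ r) N.* (2 N.* r)
  blocks n r r≤n = DM.m/n*n≤m n r , NP.≤-trans (NP.≤-reflexive (DM.m≡m%n+[m/n]*n n r))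
    (NP.≤-trans (NP.+-monoˡ-≤ (m N.* r) (NP.≤-trans (NP.<⇒≤ (DM.m%n<n n r))
                  (NP.≤-trans (NP.≤-reflexive (sym (NP.*-identityˡ r))) (NP.*-monoˡ-≤ r (DM.m≥n⇒m/n>0 r≤n)))))
      (NP.≤-reflexive (NS.solve 2 (λ m r → m NS.:* r NS.:+ m NS.:* r NS.:= m NS.:* (NS.con 2 NS.:* r)) refl m r)))
    where
    m = n N./ r

  module _ (n : ℕ) {{_ : NonZero n}} (2≤n : 2 N.≤ n) where

    private
      u = + 1 / n
      L = ⌈log₂ n ⌉

    -- Bernoulli: (1 - 1/n)^⌈n/2⌉ ≥ 1 - ⌈n/2⌉/n ≥ 1/4, hence (1 - 1/n)ⁿ ≥ 1/16
    ⌈n/2⌉/n≤3/4 : ι ⌈ n /2⌉ * u ≤ + 3 / 4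
    ⌈n/2⌉/n≤3/4 = begin
      ι m * u                       ≡⟨ scale (ι m) u ⟩
      (ι 4 * ι m) * u * (+ 1 / 4)   ≡⟨ cong (λ t → t * u * (+ 1 / 4)) (sym (ι-* 4 m)) ⟩
      ι (4 N.* m) * u * (+ 1 / 4)   ≤⟨ mul-monoʳ (0≤1/n 4) (mul-monoʳ (0≤1/n n) (ι-mono 4m≤3n)) ⟩
      ι (3 N.* n) * u * (+ 1 / 4)   ≡⟨ cong (λ t → t * u * (+ 1 / 4)) (ι-* 3 n) ⟩
      (ι 3 * ι n) * u * (+ 1 / 4)   ≡⟨ regroup (ι n) u ⟩
      ι 3 * (u * ι n) * (+ 1 / 4)   ≡⟨ cong (λ t → ι 3 * t * (+ 1 / 4)) (1/n*n≡1 n) ⟩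
      + 3 / 4                       ∎
      where
      m = ⌈ n /2⌉
      open +-*-Solver
      scale : ∀ x y → x * y ≡ (ι 4 * x) * y * (+ 1 / 4)
      scale = solve 2 (λ x y → x :* y := (con (ι 4) :* x) :* y :* con (+ 1 / 4)) refl
      regroup : ∀ x y → (ι 3 * x) * y * (+ 1 / 4) ≡ ι 3 * (y * x) * (+ 1 / 4)
      regroup = solve 2 (λ x y → (con (ι 3) :* x) :* y :* con (+ 1 / 4) := con (ι 3) :* (y :* x) :* con (+ 1 / 4)) refl
      4m≤3n : 4 N.* m N.≤ 3 N.* n
      4m≤3n = NP.≤-trans (NP.≤-reflexive (NP.*-assoc 2 2 m)) (NP.≤-trans (NP.*-monoʳ-≤ 2 (2*⌈n/2⌉≤n+1 n))
            (NP.≤-trans (NP.≤-reflexive (NP.*-distribˡ-+ 2 1 n)) (NP.+-monoˡ-≤ (2 N.* n) 2≤n)))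

    [1-1/n]ⁿ≥1/16 : + 1 / 16 ≤ (1ℚ - u) ^ℚ n
    [1-1/n]ⁿ≥1/16 = begin
      + 1 / 16                       ≡⟨ refl ⟩
      (+ 1 / 4) ^ℚ 2                 ≤⟨ pow-mono 2 (0≤1/n 4) quarter≤ ⟩
      ((1ℚ - u) ^ℚ m) ^ℚ 2           ≡⟨ sym (pow-* (1ℚ - u) m 2) ⟩
      (1ℚ - u) ^ℚ (m N.* 2)          ≤⟨ pow-antitone n (m N.* 2) (0≤1-1/n n) (1-1/n≤1 n)
                                         (NP.≤-trans (2*⌈n/2⌉≥n n) (NP.≤-reflexive (NP.*-comm 2 m))) ⟩
      (1ℚ - u) ^ℚ n                  ∎
      where
      m = ⌈ n /2⌉
      quarter≤ : + 1 / 4 ≤ (1ℚ - u) ^ℚ m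
      quarter≤ = ≤-trans (+-monoʳ-≤ 1ℚ (neg-antimono-≤ ⌈n/2⌉/n≤3/4)) (bernoulli⁻ m (0≤1/n n) (1/n≤1 n))

    private
      ε : ℚ
      ε = u ^ℚ 2 * (+ 1 / 32)

      ρ≤1-ε : ρ n ≤ 1ℚ - ε
      ρ≤1-ε = +-monoʳ-≤ 1ℚ (neg-antimono-≤ (begin
        u ^ℚ 2 * (+ 1 / 32)                ≡⟨ refl ⟩
        u ^ℚ 2 * (+ 1 / 16 * ½)            ≤⟨ mul-monoˡ (pow-nonNeg 2 (0≤1/n n)) (mul-monoʳ 0≤½ [1-1/n]ⁿ≥1/16) ⟩
        u ^ℚ 2 * ((1ℚ - u) ^ℚ n * ½)       ≡⟨ sym (*-assoc (u ^ℚ 2) ((1ℚ - u) ^ℚ n) ½) ⟩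
        q n * ½                            ∎))

      32n²*ε≡1 : ι (32 N.* n N.* n) * ε ≡ 1ℚ
      32n²*ε≡1 = begin-equality
        ι (32 N.* n N.* n) * ε                      ≡⟨ cong (_* ε) (trans (ι-* (32 N.* n) n) (cong (_* ι n) (ι-* 32 n))) ⟩
        ι 32 * ι n * ι n * (u * (u * 1ℚ) * (+ 1 / 32)) ≡⟨ regroup (ι n) u ⟩
        (ι 32 * (+ 1 / 32)) * (u * ι n) * (u * ι n)  ≡⟨ cong₂ (λ s t → (ι 32 * (+ 1 / 32)) * s * t) (1/n*n≡1 n) (1/n*n≡1 n) ⟩
        1ℚ                                           ∎
        where
        open +-*-Solver
        regroup : ∀ N U → ι 32 * N * N * (U * (U * 1ℚ) * (+ 1 / 32)) ≡ (ι 32 * (+ 1 / 32)) * (U * N) * (U * N)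
        regroup = solve 2 (λ N U → con (ι 32) :* N :* N :* (U :* (U :* con 1ℚ) :* con (+ 1 / 32))
                               := (con (ι 32) :* con (+ 1 / 32)) :* (U :* N) :* (U :* N)) refl

      0≤ε : 0ℚ ≤ ε
      0≤ε = mul-nonNeg (pow-nonNeg 2 (0≤1/n n)) (0≤1/n 32)

      ε≤1 : ε ≤ 1ℚ
      ε≤1 = ≤-trans (mul-mono (0≤ι 1) (0≤1/n 32) (pow≤1 2 (0≤1/n n) (1/n≤1 n)) (1/n≤1 32)) (≤-reflexive (*-identityˡ 1ℚ))

    dense-failure-small : ∀ c → ρ n ^ℚ (32 N.* (1 N.+ c) N.* (n N.^ 4) N.* L) * ι 2 ^ℚ (n N.* n) * ι (n N.^ c) ≤ 1ℚ
    dense-failure-small c = begin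
      ρ n ^ℚ T * ι 2 ^ℚ (n N.* n) * ι (n N.^ c)   ≤⟨ mul-monoʳ (0≤ι (n N.^ c)) (mul-monoʳ (pow-nonNeg (n N.* n) (0≤ι 2)) ρ^T≤½^r) ⟩
      ½ ^ℚ r * ι 2 ^ℚ (n N.* n) * ι (n N.^ c)      ≡⟨ *-assoc (½ ^ℚ r) (ι 2 ^ℚ (n N.* n)) (ι (n N.^ c)) ⟩
      ½ ^ℚ r * (ι 2 ^ℚ (n N.* n) * ι (n N.^ c))    ≤⟨ mul-monoˡ (pow-nonNeg r 0≤½) 2^[n²]*n^c≤2^r ⟩
      ½ ^ℚ r * ι 2 ^ℚ r                          ≡⟨ ½ⁿ*2ⁿ≡1 r ⟩
      1ℚ                                         ∎
      where
      T = 32 N.* (1 N.+ c) N.* (n N.^ 4) N.* L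
      r = (1 N.+ c) N.* (n N.* n) N.* L
      T≡ : T ≡ (32 N.* n N.* n) N.* r
      T≡ = NS.solve 3 (λ c n L → NS.con 32 NS.:* (NS.con 1 NS.:+ c) NS.:* (n NS.:^ 4) NS.:* L
                            NS.:= (NS.con 32 NS.:* n NS.:* n) NS.:* ((NS.con 1 NS.:+ c) NS.:* (n NS.:* n) NS.:* L)) refl c n L
      ρ^T≤½^r : ρ n ^ℚ T ≤ ½ ^ℚ r
      ρ^T≤½^r = begin
        ρ n ^ℚ T                                 ≤⟨ pow-mono T (Drift.0≤ρ n) ρ≤1-ε ⟩
        (1ℚ - ε) ^ℚ T                            ≡⟨ cong ((1ℚ - ε) ^ℚ_) T≡ ⟩
        (1ℚ - ε) ^ℚ ((32 N.* n N.* n) N.* r)     ≤⟨ halving-pow (32 N.* n N.* n) r 0≤ε ε≤1 (≤-reflexive (sym 32n²*ε≡1)) ⟩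
        ½ ^ℚ r                                   ∎
      1≤n : 1 N.≤ n
      1≤n = NP.≤-trans (N.s≤s N.z≤n) 2≤n
      n²+Lc≤r : n N.* n N.+ L N.* c N.≤ r
      n²+Lc≤r = NP.≤-trans (NP.+-mono-≤ (NP.≤-trans (NP.≤-reflexive (sym (NP.*-identityʳ (n N.* n)))) (NP.*-monoʳ-≤ (n N.* n) (1≤log₂ n 2≤n)))
                                        (NP.≤-trans (NP.≤-reflexive (NP.*-comm L c))
                                          (NP.*-monoʳ-≤ c (NP.≤-trans (NP.≤-reflexive (sym (NP.*-identityˡ L)))
                                                                        (NP.*-monoˡ-≤ L (NP.*-mono-≤ 1≤n 1≤n))))))
                  (NP.≤-reflexive (NS.solve 3 (λ c k L → k NS.:* L NS.:+ c NS.:* (k NS.:* L) NS.:= (NS.con 1 NS.:+ c) NS.:* k NS.:* L) refl c (n N.* n) L))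
      2^[n²]*n^c≤2^r : ι 2 ^ℚ (n N.* n) * ι (n N.^ c) ≤ ι 2 ^ℚ r
      2^[n²]*n^c≤2^r = begin
        ι 2 ^ℚ (n N.* n) * ι (n N.^ c)          ≤⟨ mul-monoˡ (pow-nonNeg (n N.* n) (0≤ι 2)) (n^c≤2^[L*c] n c) ⟩
        ι 2 ^ℚ (n N.* n) * ι 2 ^ℚ (L N.* c)     ≡⟨ sym (pow-+ (ι 2) (n N.* n) (L N.* c)) ⟩
        ι 2 ^ℚ (n N.* n N.+ L N.* c)            ≤⟨ pow-monotone (n N.* n N.+ L N.* c) r (ι-mono {1} {2} (N.s≤s N.z≤n)) n²+Lc≤r ⟩
        ι 2 ^ℚ r                                ∎

    module _ (c A : ℕ) (1≤A : 1 N.≤ A) (c₁ : ℚ) (c₁A≥1 : 1ℚ ≤ c₁ * ι A) where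

      r : ℕ
      r = L N.* (c N.+ 2)

      empty-window-small : A N.* 2 N.* (c N.+ 2) N.* L N.≤ n →
        0ℚ ≤ 1ℚ - (c₁ * u) * ι (A N.* 2 N.* (c N.+ 2) N.* L) →
        (1ℚ - (c₁ * u) * ι (A N.* 2 N.* (c N.+ 2) N.* L)) ^ℚ n ≤ ½ ^ℚ r
      empty-window-small B≤n 0≤1-y = begin
        (1ℚ - y) ^ℚ n          ≤⟨ pow-mono n 0≤1-y (+-monoʳ-≤ 1ℚ (neg-antimono-≤ y'≤y)) ⟩
        (1ℚ - y') ^ℚ n         ≤⟨ pow-antitone (m N.* r) n (sub-nonNeg y'≤1) (+-monoʳ-≤ 1ℚ (neg-antimono-≤ 0≤y')) mr≤n ⟩
        (1ℚ - y') ^ℚ (m N.* r) ≤⟨ halving-pow m r 0≤y' y'≤1 1≤my' ⟩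
        ½ ^ℚ r                 ∎
        where
        B = A N.* 2 N.* (c N.+ 2) N.* L
        B≡ : B ≡ A N.* (2 N.* r)
        B≡ = NS.solve 3 (λ A c L → A NS.:* NS.con 2 NS.:* (c NS.:+ NS.con 2) NS.:* L
                               NS.:= A NS.:* (NS.con 2 NS.:* (L NS.:* (c NS.:+ NS.con 2)))) refl A c L
        1≤r : 1 N.≤ r
        1≤r = NP.*-mono-≤ (1≤log₂ n 2≤n) (NP.≤-trans (N.s≤s N.z≤n) (NP.m≤n+m 2 c))
        instance
          r≢0 : NonZero r
          r≢0 = N.>-nonZero 1≤r
        -- y' = 2r/n is the weight of a window of width 2r at the least possible density 1/n
        y y' : ℚ
        y = (c₁ * u) * ι B
        y' = u * ι (2 N.* r)
        0≤y' : 0ℚ ≤ y'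
        0≤y' = mul-nonNeg (0≤1/n n) (0≤ι (2 N.* r))
        y'≤y : y' ≤ y
        y'≤y = begin
          y'                             ≡⟨ sym (*-identityˡ y') ⟩
          1ℚ * y'                        ≤⟨ mul-monoʳ 0≤y' c₁A≥1 ⟩
          (c₁ * ι A) * (u * ι (2 N.* r)) ≡⟨ interchange c₁ (ι A) u (ι (2 N.* r)) ⟩
          (c₁ * u) * (ι A * ι (2 N.* r)) ≡⟨ cong ((c₁ * u) *_) (trans (sym (ι-* A (2 N.* r))) (cong ι (sym B≡))) ⟩
          y                              ∎
          where
          open +-*-Solver
          interchange : ∀ a b c d → (a * b) * (c * d) ≡ (a * c) * (b * d)
          interchange = solve 4 (λ a b c d → (a :* b) :* (c :* d) := (a :* c) :* (b :* d)) refl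
        y'≤1 : y' ≤ 1ℚ
        y'≤1 = ≤-trans y'≤y (≤-trans (≤-+-nonNeg 0≤1-y) (≤-reflexive (y+[1-y]≡1 y)))
          where
          open +-*-Solver
          y+[1-y]≡1 : ∀ y → y + (1ℚ - y) ≡ 1ℚ
          y+[1-y]≡1 = solve 1 (λ y → y :+ (con 1ℚ :- y) := con 1ℚ) refl
        2r≤n : 2 N.* r N.≤ n
        2r≤n = NP.≤-trans (NP.≤-trans (NP.≤-reflexive (sym (NP.*-identityˡ (2 N.* r)))) (NP.*-monoˡ-≤ (2 N.* r) 1≤A))
                          (NP.≤-trans (NP.≤-reflexive (sym B≡)) B≤n)
        -- split the n factors into m blocks of r, each block of weight ≥ 1
        m : ℕ
        m = n N./ r
        mr≤n : m N.* r N.≤ n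
        mr≤n = proj₁ (blocks n r (NP.≤-trans (NP.m≤m+n r (r N.+ 0)) 2r≤n))
        n≤m*2r : n N.≤ m N.* (2 N.* r)
        n≤m*2r = proj₂ (blocks n r (NP.≤-trans (NP.m≤m+n r (r N.+ 0)) 2r≤n))
        1≤my' : 1ℚ ≤ ι m * y'
        1≤my' = begin
          1ℚ                            ≡⟨ sym (1/n*n≡1 n) ⟩
          u * ι n                       ≤⟨ mul-monoˡ (0≤1/n n) (ι-mono n≤m*2r) ⟩
          u * ι (m N.* (2 N.* r))       ≡⟨ cong (u *_) (ι-* m (2 N.* r)) ⟩
          u * (ι m * ι (2 N.* r))       ≡⟨ swap-front u (ι m) (ι (2 N.* r)) ⟩
          ι m * y'                      ∎
          where
          open +-*-Solver
          swap-front : ∀ a b c → a * (b * c) ≡ b * (a * c)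
          swap-front = solve 3 (λ a b c → a :* (b :* c) := b :* (a :* c)) refl

      union-of-windows-small : ι (suc n) * ½ ^ℚ r * ι (n N.^ c) ≤ 1ℚ
      union-of-windows-small = begin
        ι (suc n) * ½ ^ℚ r * ι (n N.^ c)     ≡⟨ regroup (ι (suc n)) (½ ^ℚ r) (ι (n N.^ c)) ⟩
        ½ ^ℚ r * (ι (suc n) * ι (n N.^ c))   ≡⟨ cong (½ ^ℚ r *_) (sym (ι-* (suc n) (n N.^ c))) ⟩
        ½ ^ℚ r * ι (suc n N.* n N.^ c)       ≤⟨ mul-monoˡ (pow-nonNeg r 0≤½) (≤-trans (ι-mono n+1*n^c≤n^[c+2]) (n^c≤2^[L*c] n (c N.+ 2))) ⟩
        ½ ^ℚ r * ι 2 ^ℚ r                   ≡⟨ ½ⁿ*2ⁿ≡1 r ⟩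
        1ℚ                                  ∎
        where
        open +-*-Solver
        regroup : ∀ a b c → a * b * c ≡ b * (a * c)
        regroup = solve 3 (λ a b c → a :* b :* c := b :* (a :* c)) refl
        n+1≤n² : suc n N.≤ n N.* n
        n+1≤n² = NP.≤-trans (NP.+-monoˡ-≤ n (NP.≤-trans (N.s≤s N.z≤n) 2≤n))
          (NP.≤-trans (NP.≤-reflexive (cong (n N.+_) (sym (NP.+-identityʳ n)))) (NP.*-monoˡ-≤ n 2≤n))
        n+1*n^c≤n^[c+2] : suc n N.* n N.^ c N.≤ n N.^ (c N.+ 2)
        n+1*n^c≤n^[c+2] = NP.≤-trans (NP.*-monoˡ-≤ (n N.^ c) n+1≤n²) (NP.≤-reflexive
          (trans (NP.*-comm (n N.* n) (n N.^ c)) (trans (cong (λ e → n N.^ c N.* (n N.* e)) (sym (NP.*-identityʳ n)))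
            (sym (NP.^-distribˡ-+-* n c 2)))))


module Assembly where

  -- On a dense instance the EA fails with probability
  -- ≤ ε = ρ^T 2^(n²); otherwise it fails with probability ≤ 1 ≤ #(empty windows).  Hence the
  -- total failure probability is at most ε + Σ_s Pr(window s empty) ≤ ε + (n+1)·2^(-r).

  open import Data.Nat using (ℕ; NonZero)
  import Data.Nat as N
  import Data.Nat.Properties as NP
  open import Data.Nat.Logarithm using (⌈log₂_⌉)
  open import Data.Integer using (+_)
  open import Data.Fin using (Fin)
  import Data.Fin as F
  open import Data.Vec using (Vec; []; _∷_)
  open import Data.List using (allFin; downFrom)
  open import Data.Sum using (inj₁; inj₂)
  open import Relation.Nullary using (¬_; yes; no)
  open import Data.Rational hiding (truncate; NonZero)
  open import Data.Rational.Properties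
  open import Relation.Binary.PropositionalEquality hiding ([_])
  open import Defs
  open RationalArith
  open FiniteSums
  open Improvement using (Dense)
  open Drift using (module Run; ρ; 0≤ρ)
  open Windows
  open Estimates
  open ≤-Reasoning

  instProb≡prodV : ∀ {n k} (μ : Fin k → Fin n → ℚ) (p : Vec (Fin n) k) → instProb μ p ≡ prodV μ p
  instProb≡prodV μ [] = refl
  instProb≡prodV μ (i ∷ p) = cong (μ F.zero i *_) (instProb≡prodV (λ j → μ (F.suc j)) p)

  module _ (n : ℕ) {{_ : NonZero n}} (μ : Fin n → Fin n → ℚ) (l : ℚ) (0≤l : 0ℚ ≤ l)
           (μ-sum : ∀ j → S (μ j) (allFin n) ≡ 1ℚ) (μ≥l : ∀ j i → l ≤ μ j i) where

    private
      Ins = allInstances n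
      E[_] : (Instance n → ℚ) → ℚ
      E[ f ] = S (λ p → prodV μ p * f p) Ins

    total-mass : S (prodV μ) Ins ≡ 1ℚ
    total-mass = trans (S-prodV (allFin n) n μ) (Π-≡1 n _ μ-sum)

    expectation-bound : (f W : Instance n → ℚ) (ε E : ℚ) → (∀ p → f p ≤ ε + W p) → E[ W ] ≤ E → E[ f ] ≤ ε + E
    expectation-bound f W ε E f≤ε+W EW≤E = begin
      E[ f ]                                                     ≤⟨ S-mono Ins (λ p → mul-monoˡ (prodV-nonNeg μ 0≤μ p) (f≤ε+W p)) ⟩
      S (λ p → prodV μ p * (ε + W p)) Ins                        ≡⟨ S-cong Ins (λ p → *-distribˡ-+ (prodV μ p) ε (W p)) ⟩
      S (λ p → prodV μ p * ε + prodV μ p * W p) Ins              ≡⟨ S-+ _ _ Ins ⟩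
      S (λ p → prodV μ p * ε) Ins + E[ W ]                       ≡⟨ cong (_+ E[ W ]) (trans (S-*ʳ ε (prodV μ) Ins)
                                                                      (trans (cong (_* ε) total-mass) (*-identityˡ ε))) ⟩
      ε + E[ W ]                                                 ≤⟨ +-monoʳ-≤ ε EW≤E ⟩
      ε + E                                                      ∎
      where
      0≤μ : ∀ j i → 0ℚ ≤ μ j i
      0≤μ j i = ≤-trans 0≤l (μ≥l j i)

    totalFailProb≡ : ∀ (x₀ : Instance n → Bits n) (B T : ℕ) → totalFailProb n μ x₀ B T ≡ E[ (λ p → failProb n p B (x₀ p) T) ]
    totalFailProb≡ x₀ B T = S-cong Ins (λ p → cong (_* failProb n p B (x₀ p) T) (instProb≡prodV μ p))

    totalFailProb≤1 : ∀ (x₀ : Instance n → Bits n) (B T : ℕ) → totalFailProb n μ x₀ B T ≤ 1ℚ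
    totalFailProb≤1 x₀ B T = begin
      totalFailProb n μ x₀ B T   ≡⟨ totalFailProb≡ x₀ B T ⟩
      E[ (λ p → failProb n p B (x₀ p) T) ]
        ≤⟨ expectation-bound _ (λ _ → 1ℚ) 0ℚ 1ℚ (λ p → ≤-trans (Run.failProb≤1 n p B (x₀ p) T) (≤-reflexive (sym (+-identityˡ 1ℚ))))
             (≤-reflexive (trans (S-cong Ins (λ p → *-identityʳ (prodV μ p))) total-mass)) ⟩
      0ℚ + 1ℚ                    ≡⟨ +-identityˡ 1ℚ ⟩
      1ℚ                         ∎

    module _ (B : ℕ) where

      emptyWindows : Instance n → ℚ
      emptyWindows p = S (λ s → [ emptyWindow n B s p ]) (downFrom (N.suc n))

      expected-empty-windows : (E₁ : ℚ) → 0ℚ ≤ E₁ →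
        (B N.≤ n → 0ℚ ≤ 1ℚ - l * ι B → (1ℚ - l * ι B) ^ℚ n ≤ E₁) → E[ emptyWindows ] ≤ ι (N.suc n) * E₁
      expected-empty-windows E₁ 0≤E₁ bound = begin
        E[ emptyWindows ]
          ≡⟨ S-cong Ins (λ p → sym (S-*ˡ (prodV μ p) (λ s → [ emptyWindow n B s p ]) windows)) ⟩
        S (λ p → S (λ s → prodV μ p * [ emptyWindow n B s p ]) windows) Ins
          ≡⟨ S-swap (λ p s → prodV μ p * [ emptyWindow n B s p ]) Ins windows ⟩
        S (λ s → S (λ p → prodV μ p * [ emptyWindow n B s p ]) Ins) windows
          ≤⟨ S-mono windows (λ s → empty-window-probability n B μ l 0≤l μ-sum μ≥l s E₁ 0≤E₁
                                     (λ fits → bound (NP.≤-trans (NP.m≤n+m B s) fits))) ⟩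
        S (λ _ → E₁) windows
          ≡⟨ S-const E₁ (N.suc n) ⟩
        ι (N.suc n) * E₁ ∎
        where
        windows = downFrom (N.suc n)

      failure-split : ∀ (x₀ : Instance n → Bits n) (T : ℕ) (ε : ℚ) → 0ℚ ≤ ε → (∀ p → Dense B p → failProb n p B (x₀ p) T ≤ ε) →
        ∀ p → failProb n p B (x₀ p) T ≤ ε + emptyWindows p
      failure-split x₀ T ε 0≤ε dense-bound p with nowhere-or-counted (λ s → emptyWindow n B s p) (N.suc n)
      ... | inj₁ none = ≤-trans (dense-bound p (no-empty-window⇒dense n B p none))
                                (≤-+-nonNeg (S-nonNeg (downFrom (N.suc n)) (λ s → []-nonNeg (emptyWindow n B s p))))
      ... | inj₂ some = ≤-trans (Run.failProb≤1 n p B (x₀ p) T)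
                          (≤-trans some (≤-trans (≤-reflexive (sym (+-identityˡ (emptyWindows p)))) (+-monoˡ-≤ (emptyWindows p) 0≤ε)))

  module _ (c A : ℕ) (1≤A : 1 N.≤ A) (c₁ : ℚ) (0≤c₁ : 0ℚ ≤ c₁) (1≤c₁A : 1ℚ ≤ c₁ * ι A)
           (n : ℕ) {{_ : NonZero n}} (μ : Fin n → Fin n → ℚ) (μ-sum : ∀ j → S (μ j) (allFin n) ≡ 1ℚ)
           (μ≥ : ∀ j i → c₁ * (+ 1 / n) ≤ μ j i) (x₀ : Instance n → Bits n) where

    private
      B T : ℕ
      B = A N.* 2 N.* (c N.+ 2) N.* ⌈log₂ n ⌉
      T = 32 N.* (1 N.+ c) N.* (n N.^ 4) N.* ⌈log₂ n ⌉
      l : ℚ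
      l = c₁ * (+ 1 / n)
      0≤l : 0ℚ ≤ l
      0≤l = mul-nonNeg 0≤c₁ (0≤1/n n)

    -- for n ≤ 1 the trivial bound suffices
    failure-bound-small-n : ¬ (2 N.≤ n) → totalFailProb n μ x₀ B T * ι (n N.^ c) ≤ ι 2
    failure-bound-small-n n<2 = begin
      totalFailProb n μ x₀ B T * ι (n N.^ c)
        ≤⟨ mul-mono (0≤ι 1) (0≤ι (n N.^ c)) (totalFailProb≤1 n μ l 0≤l μ-sum μ≥ x₀ B T) n^c≤1 ⟩
      1ℚ * 1ℚ  ≤⟨ ι-mono {1} {2} (N.s≤s N.z≤n) ⟩
      ι 2      ∎
      where
      n^c≤1 : ι (n N.^ c) ≤ 1ℚ
      n^c≤1 = ι-mono (NP.≤-trans (NP.^-monoˡ-≤ c (NP.≤-pred (NP.≰⇒> n<2))) (NP.≤-reflexive (NP.^-zeroˡ c)))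

    failure-bound-large-n : 2 N.≤ n → totalFailProb n μ x₀ B T * ι (n N.^ c) ≤ ι 2
    failure-bound-large-n 2≤n = begin
      totalFailProb n μ x₀ B T * ι (n N.^ c)  ≤⟨ mul-monoʳ (0≤ι (n N.^ c)) TF≤ε+E ⟩
      (ε + E) * ι (n N.^ c)                   ≡⟨ *-distribʳ-+ (ι (n N.^ c)) ε E ⟩
      ε * ι (n N.^ c) + E * ι (n N.^ c)       ≤⟨ +-mono-≤ (dense-failure-small n 2≤n c) (union-of-windows-small n 2≤n c A 1≤A c₁ 1≤c₁A) ⟩
      1ℚ + 1ℚ                                 ≡⟨ refl ⟩
      ι 2                                     ∎
      where
      ε = ρ n ^ℚ T * ι 2 ^ℚ (n N.* n)
      0≤ε : 0ℚ ≤ ε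
      0≤ε = mul-nonNeg (pow-nonNeg T (0≤ρ n)) (pow-nonNeg (n N.* n) (0≤ι 2))
      halvings = r n 2≤n c A 1≤A c₁ 1≤c₁A
      E = ι (N.suc n) * ½ ^ℚ halvings
      TF≤ε+E : totalFailProb n μ x₀ B T ≤ ε + E
      TF≤ε+E = ≤-trans (≤-reflexive (totalFailProb≡ n μ l 0≤l μ-sum μ≥ x₀ B T))
        (expectation-bound n μ l 0≤l μ-sum μ≥ _ (emptyWindows n μ l 0≤l μ-sum μ≥ B) ε E
          (failure-split n μ l 0≤l μ-sum μ≥ B x₀ T ε 0≤ε (λ p dense → Run.failProb-dense n p B (x₀ p) dense T))
          (expected-empty-windows n μ l 0≤l μ-sum μ≥ B (½ ^ℚ halvings) (pow-nonNeg halvings 0≤½)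
            (empty-window-small n 2≤n c A 1≤A c₁ 1≤c₁A)))

  failure-bound : ∀ (c A : ℕ) → 1 N.≤ A → (c₁ : ℚ) → 0ℚ ≤ c₁ → 1ℚ ≤ c₁ * ι A →
    ∀ n {{_ : NonZero n}} (μ : Fin n → Fin n → ℚ) → (∀ j → S (μ j) (allFin n) ≡ 1ℚ) →
    (∀ j i → c₁ * (+ 1 / n) ≤ μ j i) → (x₀ : Instance n → Bits n) →
    totalFailProb n μ x₀ (A N.* 2 N.* (c N.+ 2) N.* ⌈log₂ n ⌉) (32 N.* (1 N.+ c) N.* (n N.^ 4) N.* ⌈log₂ n ⌉)
      * ι (n N.^ c) ≤ ι 2
  failure-bound c A 1≤A c₁ 0≤c₁ 1≤c₁A n μ μ-sum μ≥ x₀ with 2 N.≤? n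
  ... | no n<2 = failure-bound-small-n c A 1≤A c₁ 0≤c₁ 1≤c₁A n μ μ-sum μ≥ x₀ n<2
  ... | yes 2≤n = failure-bound-large-n c A 1≤A c₁ 0≤c₁ 1≤c₁A n μ μ-sum μ≥ x₀ 2≤n


open import Defs
open import Data.Nat using (ℕ; NonZero; _*_; _^_; _+_; >-nonZero; >-nonZero⁻¹)
open import Data.Nat.Logarithm using (⌈log₂_⌉)
open import Data.Fin using (Fin)
open import Data.List using (map; allFin)
open import Data.Product using (∃-syntax; _×_; _,_; proj₁)
open import Data.Integer using (+_)
open import Relation.Binary.PropositionalEquality using (_≡_)
open import Data.Rational using (ℚ; 0ℚ; 1ℚ; _<_; _≤_; _/_) renaming (_*_ to _*ℚ_)
open import Data.Rational.Properties using (<⇒≤)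
open RationalArith using (archimedean)
open Assembly using (failure-bound)

theorem4 : (c₁ c₂ : ℚ) → 0ℚ < c₁ → 0ℚ < c₂ → (c : ℕ) →
  ∃[ C ] ∃[ K ] ∃[ D ]
    ((n : ℕ) .{{_ : NonZero n}} →
     (μ : Fin n → Fin n → ℚ) →
     ((j : Fin n) → Σℚ (map (μ j) (allFin n)) ≡ 1ℚ) →
     ((j i : Fin n) → (c₁ *ℚ (+ 1 / n)) ≤ μ j i × μ j i ≤ (c₂ *ℚ (+ 1 / n))) →
     (x₀ : Instance n → Bits n) →
     (totalFailProb n μ x₀ (C * ⌈log₂ n ⌉) (K * (n ^ 4) * ⌈log₂ n ⌉)
        *ℚ (+ (n ^ c) / 1)) ≤ (+ D / 1))
theorem4 c₁ c₂ 0<c₁ _ c with archimedean c₁ 0<c₁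
... | A , 1≤A , 1≤c₁A = A * 2 * (c + 2) , 32 * (1 + c) , 2 ,
  -- only the lower bound c₁/n on the size distribution is used; the irrelevant instance
  -- NonZero n is rebuilt as a relevant one from n > 0
  λ n μ μ-sum μ-bounds x₀ → failure-bound c A 1≤A c₁ (<⇒≤ 0<c₁) 1≤c₁A n {{>-nonZero (>-nonZero⁻¹ n)}}
                               μ μ-sum (λ j i → proj₁ (μ-bounds j i)) x₀
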